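{- Let $a\geq 4$ and $b\geq 5$ be integers, $n=a+b-2$, $V=\{1,\dots,n\}$, and consider the 2-connected $(a,b)$-puzzle given by the cycles $\alpha=(1\ 2\ \dots\ a)$ and $\beta=(a-1\ a\ a+1\ \dots\ n)$. Then every even permutation of $V$ can be generated in $O(n^2)$ shifts along $\alpha$ and $\beta$.
   Context: A shift along a cycle $\gamma$ means composing the current permutation with $\gamma$ or $\gamma^{ -1}$. "A permutation can be generated in $N$ shifts" means it is a product of at most $N$ factors, each one of the given cycles or its inverse; the $O(\cdot)$ bound is uniform in $a,b$ and in the permutation. -}

module Defs where

open import Data.Nat using (ℕ; zero; suc; _+_; _*_; _∸_; _≤_; _<_; _<?_; _≟_; s≤s)
open import Data.Nat.Properties using (≤-trans; <-≤-trans; ≤-<-trans; ≤-refl; n≤1+n; m∸n≤m)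
open import Data.Fin using (Fin; toℕ; fromℕ<)
open import Data.Fin.Properties using (toℕ<n)
open import Data.Fin.Permutation using (Permutation′; _⟨$⟩ʳ_)
open import Data.List using (List; []; _∷_; length; filter; allFin; concatMap; map)
open import Relation.Nullary using (yes; no)
open import Relation.Nullary.Decidable using (⌊_⌋)
open import Data.Bool using (true; false)

-- Points of V = {1,…,n} are modelled 0-indexed as Fin n = {0,…,n-1}.

-- The cycle (l  l+1  …  r) on Fin n (0-indexed), for l ≤ r < n:
--   i ↦ i+1 for l ≤ i < r,  r ↦ l,  all other points fixed.
cycleFwd : ∀ {n} (l r : ℕ) → l ≤ r → r < n → Fin n → Fin n
cycleFwd l r l≤r r<n i with toℕ i <? l
... | yes _ = i
... | no _ with toℕ i <? r
...   | yes i<r = fromℕ< (≤-<-trans i<r r<n)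
...   | no _ with toℕ i ≟ r
...     | yes _ = fromℕ< (≤-<-trans l≤r r<n)
...     | no _ = i

cycleBwd : ∀ {n} (l r : ℕ) → l ≤ r → r < n → Fin n → Fin n
cycleBwd l r l≤r r<n i with toℕ i <? l
... | yes _ = i
... | no _ with toℕ i ≟ l
...   | yes _ = fromℕ< r<n
...   | no _ with toℕ i <? suc r
...     | yes _ = fromℕ< (≤-<-trans (m∸n≤m (toℕ i) 1) (toℕ<n i))
...     | no _ = i

-- The (a,b)-puzzle: n = a + b - 2,
--   α = (1 2 … a)          (0-indexed: (0 1 … a-1)),
--   β = (a-1 a … n)        (0-indexed: (a-2 a-1 … n-1)).
-- We write a = 4 + a' and b = 5 + b', so n = 7 + a' + b'.
puzzleN : ℕ → ℕ → ℕ
puzzleN a' b' = 7 + a' + b'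

data Shift : Set where
  α α⁻¹ β β⁻¹ : Shift

private
  lemα : ∀ a' b' → 3 + a' < puzzleN a' b'
  lemα a' b' = s≤s (s≤s (s≤s (s≤s (≤-trans (n≤1+n a') (≤-trans (n≤1+n (suc a')) (≤-trans (n≤1+n (suc (suc a'))) (Data.Nat.Properties.m≤m+n (suc (suc (suc a'))) b')))))))

  lemβl : ∀ a' b' → 2 + a' ≤ 6 + a' + b'
  lemβl a' b' = s≤s (s≤s (≤-trans (Data.Nat.Properties.m≤n+m a' 4) (Data.Nat.Properties.m≤m+n (4 + a') b')))

applyShift : ∀ a' b' → Shift → Fin (puzzleN a' b') → Fin (puzzleN a' b')
applyShift a' b' α   = cycleFwd 0 (3 + a') Data.Nat.z≤n (lemα a' b')
applyShift a' b' α⁻¹ = cycleBwd 0 (3 + a') Data.Nat.z≤n (lemα a' b')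
applyShift a' b' β   = cycleFwd (2 + a') (6 + a' + b') (lemβl a' b') ≤-refl
applyShift a' b' β⁻¹ = cycleBwd (2 + a') (6 + a' + b') (lemβl a' b') ≤-refl

runShifts : ∀ a' b' → List Shift → Fin (puzzleN a' b') → Fin (puzzleN a' b')
runShifts a' b' []       x = x
runShifts a' b' (s ∷ ss) x = applyShift a' b' s (runShifts a' b' ss x)

inversions : ∀ {n} → Permutation′ n → ℕ
inversions {n} σ =
  length (filter (λ p → Data.Nat._<?_ (toℕ (σ ⟨$⟩ʳ Data.Product.proj₂ p)) (toℕ (σ ⟨$⟩ʳ Data.Product.proj₁ p)))
                 (filter (λ p → Data.Nat._<?_ (toℕ (Data.Product.proj₁ p)) (toℕ (Data.Product.proj₂ p)))
                         (concatMap (λ i → map (λ j → i Data.Product., j) (allFin n)) (allFin n))))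
  where import Data.Product

IsEven : ∀ {n} → Permutation′ n → Set
IsEven σ = Data.Nat.Divisibility._∣_ 2 (inversions σ)
  where import Data.Nat.Divisibility

-- Write a = 4 + a' and count positions from 0, so that α cycles 0 … a−1 and β cycles a−2 … n−1.
-- The commutator αβα⁻¹β⁻¹ is the double transposition (0 a)(a−2 a−1); conjugating it by
-- γ = β⁻¹α⁻¹β⁻¹αβ² gives (0 a)(n−1 a−1), and the product of the two is the 3-cycle
-- (a−2 a−1)(n−1 a−1). Conjugating by β² or by α⁻² turns it into (a a+1)(a−1 a+1) or
-- (a−4 a−3)(n−1 a−3), and conjugating further by a power of α, resp. β, of length at most n
-- replaces a−1, resp. n−1, by an arbitrary point x of that generator's support. The quotient
-- of two such words is a 3-cycle (t h)(y h) through the hub h = a+1, resp. a−3: it moves y to t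
-- with O(n) shifts and fixes everything else. Putting the points in place one at a time,
-- relaying through a−1 when y and t lie on different sides, costs O(n²) shifts and leaves a
-- permutation of the two hubs. That permutation is the identity: every word used is a product
-- of pairs of transpositions, so it preserves the parity of the number of inversions, and the
-- target is even.

module Submission where

open import Defs
open import Data.Bool using (Bool; true; false; _∧_; _xor_; if_then_else_; T)
open import Data.Bool.Properties using (xor-same; ∧-distribˡ-xor)
open import Data.Empty using (⊥-elim)
open import Data.Fin using (Fin; zero; suc; toℕ; fromℕ<)
open import Data.Fin.Properties using (toℕ<n; toℕ-injective; toℕ-fromℕ<) renaming (_≟_ to _≟ᶠ_)
open import Data.Fin.Permutation using (Permutation′; _⟨$⟩ʳ_; _⟨$⟩ˡ_; inverseʳ; _∘ₚ_; _≈_; permutation)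
  renaming (transpose to transposeₚ)
import Data.Fin.Permutation as Perm
open import Data.Fin.Permutation.Components using (transpose; transpose-inverse)
open import Data.List using (List; []; _∷_; [_]; _++_; length; map; filter; concatMap; allFin; tabulate; reverse; replicate)
open import Data.List.Properties using (map-tabulate; length-tabulate; length-++; length-replicate; length-map; length-reverse;
  reverse-map; reverse-involutive; unfold-reverse; map-∘; map-cong; map-id)
open import Data.List.Membership.Propositional using (_∈_)
open import Data.List.Membership.Propositional.Properties using (∈-allFin)
open import Data.List.Relation.Unary.Any using (here; there)
open import Data.Nat using (ℕ; zero; suc; _+_; _*_; _∸_; _≤_; _<_; _≤ᵇ_; _<?_; _≟_; s≤s; z≤n; z<s; s≤s⁻¹; parity)
open import Data.Nat.Properties
open import Data.Nat.Divisibility using (_∣_; divides)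
open import Data.Nat.Solver using (module +-*-Solver)
open import Data.Parity using (0ℙ; 1ℙ; _⁻¹)
import Data.Parity as ℙ
open import Data.Parity.Properties using (⁻¹-involutive; ⁻¹-selfInverse; suc-homo-⁻¹; *-homo-*) renaming (*-zeroʳ to ℙ-*-zeroʳ)
open import Data.Product using (Σ; _×_; _,_; proj₁; proj₂; ∃₂; swap)
open import Data.Sum using (_⊎_; inj₁; inj₂)
open import Function using (_∘_; id; case_of_)
open import Function.Bundles using (mk⇔; Injection)
open import Function.Properties.Inverse using (↔⇒↣)
open import Relation.Binary using (Tri; tri<; tri≈; tri>)
open import Relation.Binary.PropositionalEquality hiding ([_])
open import Relation.Nullary using (Dec; yes; no; does; ¬_; ¬?; _×-dec_; _⊎-dec_)
open import Relation.Nullary.Decidable using (dec-true; dec-false; does-⇔)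
open import Relation.Unary using (Decidable)

-- Cycles

module _ {n : ℕ} (l r : ℕ) (l≤r : l ≤ r) (r<n : r < n) where
  private
    fwd bwd : Fin n → Fin n
    fwd = cycleFwd l r l≤r r<n
    bwd = cycleBwd l r l≤r r<n

  cycleFwd-below : ∀ {i k} → toℕ i ≡ k → k < l → toℕ (fwd i) ≡ k
  cycleFwd-below {i} refl i<l with toℕ i <? l
  ... | yes _   = refl
  ... | no i≮l = ⊥-elim (i≮l i<l)

  cycleFwd-inside : ∀ {i k} → toℕ i ≡ k → l ≤ k → k < r → toℕ (fwd i) ≡ suc k
  cycleFwd-inside {i} refl l≤i i<r with toℕ i <? l
  ... | yes i<l = ⊥-elim (<⇒≱ i<l l≤i)
  ... | no _ with toℕ i <? r
  ...   | yes _   = toℕ-fromℕ< _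
  ...   | no i≮r = ⊥-elim (i≮r i<r)

  cycleFwd-last : ∀ {i} → toℕ i ≡ r → toℕ (fwd i) ≡ l
  cycleFwd-last {i} i≡r with toℕ i <? l
  ... | yes i<l = ⊥-elim (<⇒≱ i<l (subst (l ≤_) (sym i≡r) l≤r))
  ... | no _ with toℕ i <? r
  ...   | yes i<r = ⊥-elim (<⇒≢ i<r i≡r)
  ...   | no _ with toℕ i ≟ r
  ...     | yes _   = toℕ-fromℕ< _
  ...     | no i≢r = ⊥-elim (i≢r i≡r)

  cycleFwd-above : ∀ {i k} → toℕ i ≡ k → r < k → toℕ (fwd i) ≡ k
  cycleFwd-above {i} refl r<i with toℕ i <? l
  ... | yes _ = refl
  ... | no _ with toℕ i <? r
  ...   | yes i<r = ⊥-elim (<-asym r<i i<r)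
  ...   | no _ with toℕ i ≟ r
  ...     | yes i≡r = ⊥-elim (<⇒≢ r<i (sym i≡r))
  ...     | no _    = refl

  cycleBwd-below : ∀ {i k} → toℕ i ≡ k → k < l → toℕ (bwd i) ≡ k
  cycleBwd-below {i} refl i<l with toℕ i <? l
  ... | yes _   = refl
  ... | no i≮l = ⊥-elim (i≮l i<l)

  cycleBwd-first : ∀ {i} → toℕ i ≡ l → toℕ (bwd i) ≡ r
  cycleBwd-first {i} i≡l with toℕ i <? l
  ... | yes i<l = ⊥-elim (<⇒≢ i<l i≡l)
  ... | no _ with toℕ i ≟ l
  ...   | yes _   = toℕ-fromℕ< _
  ...   | no i≢l = ⊥-elim (i≢l i≡l)

  cycleBwd-inside : ∀ {i k} → toℕ i ≡ suc k → l ≤ k → k < r → toℕ (bwd i) ≡ k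
  cycleBwd-inside {i} i≡1+k l≤k k<r with toℕ i <? l
  ... | yes i<l = ⊥-elim (<⇒≱ i<l (subst (l ≤_) (sym i≡1+k) (m≤n⇒m≤1+n l≤k)))
  ... | no _ with toℕ i ≟ l
  ...   | yes i≡l = ⊥-elim (<⇒≢ (s≤s l≤k) (trans (sym i≡l) i≡1+k))
  ...   | no _ with toℕ i <? suc r
  ...     | yes _    = trans (toℕ-fromℕ< _) (cong (_∸ 1) i≡1+k)
  ...     | no i≮1+r = ⊥-elim (i≮1+r (subst (_< suc r) (sym i≡1+k) (s≤s k<r)))

  cycleBwd-above : ∀ {i k} → toℕ i ≡ k → r < k → toℕ (bwd i) ≡ k
  cycleBwd-above {i} refl r<i with toℕ i <? l
  ... | yes _ = refl
  ... | no _ with toℕ i ≟ l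
  ...   | yes i≡l = ⊥-elim (<⇒≱ r<i (subst (_≤ r) (sym i≡l) l≤r))
  ...   | no _ with toℕ i <? suc r
  ...     | yes i<1+r = ⊥-elim (<⇒≱ r<i (s≤s⁻¹ i<1+r))
  ...     | no _      = refl

  cycleBwd-cycleFwd : ∀ i → bwd (fwd i) ≡ i
  cycleBwd-cycleFwd i = toℕ-injective (bwd-fwd (<-cmp (toℕ i) l) (<-cmp (toℕ i) r))
    where
    inside : l ≤ toℕ i → toℕ i < r → toℕ (bwd (fwd i)) ≡ toℕ i
    inside l≤i i<r = cycleBwd-inside (cycleFwd-inside refl l≤i i<r) l≤i i<r

    bwd-fwd : Tri (toℕ i < l) (toℕ i ≡ l) (l < toℕ i) → Tri (toℕ i < r) (toℕ i ≡ r) (r < toℕ i) →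
              toℕ (bwd (fwd i)) ≡ toℕ i
    bwd-fwd (tri< i<l _ _) _ = cycleBwd-below (cycleFwd-below refl i<l) i<l
    bwd-fwd _ (tri≈ _ i≡r _) = trans (cycleBwd-first (cycleFwd-last i≡r)) (sym i≡r)
    bwd-fwd _ (tri> _ _ r<i) = cycleBwd-above (cycleFwd-above refl r<i) r<i
    bwd-fwd (tri≈ _ i≡l _) (tri< i<r _ _) = inside (≤-reflexive (sym i≡l)) i<r
    bwd-fwd (tri> _ _ l<i) (tri< i<r _ _) = inside (<⇒≤ l<i) i<r

  cycleFwd-cycleBwd : ∀ i → fwd (bwd i) ≡ i
  cycleFwd-cycleBwd i = toℕ-injective (fwd-bwd (<-cmp (toℕ i) l) (≤-<-connex (toℕ i) r))
    where
    fwd-bwd : Tri (toℕ i < l) (toℕ i ≡ l) (l < toℕ i) → toℕ i ≤ r ⊎ r < toℕ i → toℕ (fwd (bwd i)) ≡ toℕ i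
    fwd-bwd (tri< i<l _ _) _ = cycleFwd-below (cycleBwd-below refl i<l) i<l
    fwd-bwd (tri≈ _ i≡l _) _ = trans (cycleFwd-last (cycleBwd-first i≡l)) (sym i≡l)
    fwd-bwd (tri> _ _ _) (inj₂ r<i) = cycleFwd-above (cycleBwd-above refl r<i) r<i
    fwd-bwd (tri> _ _ l<i) (inj₁ i≤r) = trans (cycleFwd-inside (cycleBwd-inside i≡1+k l≤k k<r) l≤k k<r) (sym i≡1+k)
      where
      k : ℕ
      k = toℕ i ∸ 1
      i≡1+k : toℕ i ≡ suc k
      i≡1+k = sym (m+[n∸m]≡n (≤-trans (s≤s z≤n) l<i))
      l≤k : l ≤ k
      l≤k = s≤s⁻¹ (subst (l <_) i≡1+k l<i)
      k<r : k < r
      k<r = subst (_≤ r) i≡1+k i≤r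

-- Transpositions

module _ {n : ℕ} where

  data TransposeView (i j k : Fin n) : Set where
    at-i  : k ≡ i → TransposeView i j k
    at-j  : k ≢ i → k ≡ j → TransposeView i j k
    other : k ≢ i → k ≢ j → TransposeView i j k

  transpose-view : ∀ (i j k : Fin n) → TransposeView i j k
  transpose-view i j k with k ≟ᶠ i | k ≟ᶠ j
  ... | yes k≡i | _        = at-i k≡i
  ... | no k≢i | yes k≡j  = at-j k≢i k≡j
  ... | no k≢i | no k≢j   = other k≢i k≢j

  transpose-matchˡ : ∀ {i j k : Fin n} → k ≡ i → transpose i j k ≡ j
  transpose-matchˡ {i} {j} {k} k≡i with k ≟ᶠ i
  ... | yes _   = refl
  ... | no k≢i = ⊥-elim (k≢i k≡i)

  transpose-matchʳ : ∀ {i j k : Fin n} → k ≡ j → transpose i j k ≡ i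
  transpose-matchʳ {i} {j} {k} k≡j with k ≟ᶠ i
  ... | yes k≡i = trans (sym k≡j) k≡i
  ... | no _ with k ≟ᶠ j
  ...   | yes _   = refl
  ...   | no k≢j = ⊥-elim (k≢j k≡j)

  transpose-other : ∀ {i j k : Fin n} → k ≢ i → k ≢ j → transpose i j k ≡ k
  transpose-other {i} {j} {k} k≢i k≢j with k ≟ᶠ i
  ... | yes k≡i = ⊥-elim (k≢i k≡i)
  ... | no _ with k ≟ᶠ j
  ...   | yes k≡j = ⊥-elim (k≢j k≡j)
  ...   | no _    = refl

  transpose-comm : ∀ (i j k : Fin n) → transpose i j k ≡ transpose j i k
  transpose-comm i j k with transpose-view i j k
  ... | at-i k≡i      = trans (transpose-matchˡ k≡i) (sym (transpose-matchʳ k≡i))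
  ... | at-j _ k≡j    = trans (transpose-matchʳ k≡j) (sym (transpose-matchˡ k≡j))
  ... | other k≢i k≢j = trans (transpose-other k≢i k≢j) (sym (transpose-other k≢j k≢i))

  transpose-involutive : ∀ (i j k : Fin n) → transpose i j (transpose i j k) ≡ k
  transpose-involutive i j k = trans (cong (transpose i j) (transpose-comm i j k)) (transpose-inverse i j)

  transpose-conjugate : ∀ (g h : Fin n → Fin n) → (∀ x → g (h x) ≡ x) → (∀ x → h (g x) ≡ x) →
                        ∀ i j x → g (transpose i j (h x)) ≡ transpose (g i) (g j) x
  transpose-conjugate g h gh hg i j x with transpose-view i j (h x)
  ... | at-i hx≡i = trans (cong g (transpose-matchˡ hx≡i)) (sym (transpose-matchˡ (trans (sym (gh x)) (cong g hx≡i))))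
  ... | at-j _ hx≡j = trans (cong g (transpose-matchʳ hx≡j)) (sym (transpose-matchʳ (trans (sym (gh x)) (cong g hx≡j))))
  ... | other hx≢i hx≢j = trans (cong g (transpose-other hx≢i hx≢j))
                            (trans (gh x) (sym (transpose-other (hx≢i ∘ moved) (hx≢j ∘ moved))))
    where
    moved : ∀ {y} → x ≡ g y → h x ≡ y
    moved x≡gy = trans (cong h x≡gy) (hg _)

  transpose²-other : ∀ {i j k l x : Fin n} → x ≢ i → x ≢ j → x ≢ k → x ≢ l → transpose i j (transpose k l x) ≡ x
  transpose²-other x≢i x≢j x≢k x≢l = trans (cong (transpose _ _) (transpose-other x≢k x≢l)) (transpose-other x≢i x≢j)

-- Counting

private
  variable
    A B : Set

count : (A → Bool) → List A → ℕ
count p []       = 0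
count p (x ∷ xs) = if p x then suc (count p xs) else count p xs

count-cong : ∀ {p q : A → Bool} → (∀ x → p x ≡ q x) → ∀ xs → count p xs ≡ count q xs
count-cong p≗q []       = refl
count-cong p≗q (x ∷ xs) rewrite p≗q x = cong (λ c → if _ then suc c else c) (count-cong p≗q xs)

count-false : ∀ {p : A → Bool} → (∀ x → p x ≡ false) → ∀ xs → count p xs ≡ 0
count-false p≗false []       = refl
count-false p≗false (x ∷ xs) rewrite p≗false x = count-false p≗false xs

count-++ : ∀ (p : A → Bool) xs ys → count p (xs ++ ys) ≡ count p xs + count p ys
count-++ p []       ys = refl
count-++ p (x ∷ xs) ys with p x
... | true  = cong suc (count-++ p xs ys)
... | false = count-++ p xs ys

count-map : ∀ (p : B → Bool) (f : A → B) xs → count p (map f xs) ≡ count (p ∘ f) xs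
count-map p f []       = refl
count-map p f (x ∷ xs) with p (f x)
... | true  = cong suc (count-map p f xs)
... | false = count-map p f xs

length-filter-count : ∀ {P : A → Set} (P? : Decidable P) xs → length (filter P? xs) ≡ count (does ∘ P?) xs
length-filter-count P? []       = refl
length-filter-count P? (x ∷ xs) with does (P? x)
... | true  = cong suc (length-filter-count P? xs)
... | false = length-filter-count P? xs

count-filter : ∀ {P : A → Set} (P? : Decidable P) (p : A → Bool) xs →
               count p (filter P? xs) ≡ count (λ x → does (P? x) ∧ p x) xs
count-filter P? p []       = refl
count-filter P? p (x ∷ xs) with does (P? x)
... | false = count-filter P? p xs
... | true with p x
...   | true  = cong suc (count-filter P? p xs)
...   | false = count-filter P? p xs

count-cartesianProduct : ∀ (p q : A → Bool) xs ys →
  count (λ x → p (proj₁ x) ∧ q (proj₂ x)) (concatMap (λ i → map (i ,_) ys) xs) ≡ count p xs * count q ys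
count-cartesianProduct p q []       ys = refl
count-cartesianProduct {A} p q (i ∷ xs) ys = begin
  count r (map (i ,_) ys ++ rest)             ≡⟨ count-++ r (map (i ,_) ys) rest ⟩
  count r (map (i ,_) ys) + count r rest      ≡⟨ cong₂ _+_ (count-map r (i ,_) ys) (count-cartesianProduct p q xs ys) ⟩
  count (λ j → p i ∧ q j) ys + count p xs * count q ys ≡⟨ row (p i) (count p xs) ⟩
  count p (i ∷ xs) * count q ys               ∎
  where
  open ≡-Reasoning
  r : A × A → Bool
  r x = p (proj₁ x) ∧ q (proj₂ x)
  rest : List (A × A)
  rest = concatMap (λ i → map (i ,_) ys) xs
  row : ∀ b c → count (λ j → b ∧ q j) ys + c * count q ys ≡ (if b then suc c else c) * count q ys
  row true  c = refl
  row false c = cong (_+ c * count q ys) (count-false (λ _ → refl) ys)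

count-allFin-≟ : ∀ {n} (i : Fin n) → count (λ j → does (j ≟ᶠ i)) (allFin n) ≡ 1
count-allFin-≟ {suc n} zero = cong suc (begin
  count (λ j → does (j ≟ᶠ zero)) (tabulate {n = n} suc)     ≡⟨ cong (count _) (map-tabulate {n = n} id suc) ⟨
  count (λ j → does (j ≟ᶠ zero)) (map suc (allFin n))       ≡⟨ count-map _ suc (allFin n) ⟩
  count (λ j → does (suc j ≟ᶠ zero)) (allFin n)             ≡⟨ count-false (λ _ → refl) (allFin n) ⟩
  0                                                          ∎)
  where open ≡-Reasoning
count-allFin-≟ {suc n} (suc i) = begin
  count (λ j → does (j ≟ᶠ suc i)) (tabulate {n = n} suc)    ≡⟨ cong (count _) (map-tabulate {n = n} id suc) ⟨
  count (λ j → does (j ≟ᶠ suc i)) (map suc (allFin n))      ≡⟨ count-map _ suc (allFin n) ⟩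
  count (λ j → does (j ≟ᶠ i)) (allFin n)                    ≡⟨ count-allFin-≟ i ⟩
  1                                                          ∎
  where open ≡-Reasoning

length-allFin : ∀ {n} → length (allFin n) ≡ n
length-allFin = length-tabulate id

parity-if-suc : ∀ b m → parity (if b then suc m else m) ≡ (if b then parity m ⁻¹ else parity m)
parity-if-suc true  m = sym (⁻¹-selfInverse (suc-homo-⁻¹ m))
parity-if-suc false m = refl

if⁻¹-+-if⁻¹ : ∀ b c x y → (if b then x ⁻¹ else x) ℙ.+ (if c then y ⁻¹ else y) ≡ (if b xor c then (x ℙ.+ y) ⁻¹ else x ℙ.+ y)
if⁻¹-+-if⁻¹ true  true  0ℙ y = ⁻¹-involutive y
if⁻¹-+-if⁻¹ true  true  1ℙ y = refl
if⁻¹-+-if⁻¹ true  false 0ℙ y = refl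
if⁻¹-+-if⁻¹ true  false 1ℙ y = sym (⁻¹-involutive y)
if⁻¹-+-if⁻¹ false true  x  y = +-⁻¹ x
  where
  +-⁻¹ : ∀ x → x ℙ.+ y ⁻¹ ≡ (x ℙ.+ y) ⁻¹
  +-⁻¹ 0ℙ = refl
  +-⁻¹ 1ℙ = refl
if⁻¹-+-if⁻¹ false false x  y = refl

parity-count-xor : ∀ (p q : A → Bool) xs →
                   parity (count p xs) ℙ.+ parity (count q xs) ≡ parity (count (λ x → p x xor q x) xs)
parity-count-xor p q []       = refl
parity-count-xor p q (x ∷ xs) = begin
  parity (count p (x ∷ xs)) ℙ.+ parity (count q (x ∷ xs))  ≡⟨ cong₂ ℙ._+_ (parity-if-suc (p x) _) (parity-if-suc (q x) _) ⟩
  (if p x then P ⁻¹ else P) ℙ.+ (if q x then Q ⁻¹ else Q)  ≡⟨ if⁻¹-+-if⁻¹ (p x) (q x) P Q ⟩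
  (if p x xor q x then (P ℙ.+ Q) ⁻¹ else P ℙ.+ Q)          ≡⟨ cong (λ z → if p x xor q x then z ⁻¹ else z) (parity-count-xor p q xs) ⟩
  (if p x xor q x then E ⁻¹ else E)                         ≡⟨ parity-if-suc (p x xor q x) _ ⟨
  parity (count (λ x → p x xor q x) (x ∷ xs))               ∎
  where
  open ≡-Reasoning
  P Q E : ℙ.Parity
  P = parity (count p xs)
  Q = parity (count q xs)
  E = parity (count (λ x → p x xor q x) xs)

+≡1ℙ⇒≡⁻¹ : ∀ a b → a ℙ.+ b ≡ 1ℙ → b ≡ a ⁻¹
+≡1ℙ⇒≡⁻¹ 0ℙ b a+b≡1 = a+b≡1
+≡1ℙ⇒≡⁻¹ 1ℙ b a+b≡1 = sym (⁻¹-selfInverse a+b≡1)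

parity-even : ∀ {m} → 2 ∣ m → parity m ≡ 0ℙ
parity-even (divides q refl) = trans (*-homo-* q 2) (ℙ-*-zeroʳ (parity q))

-- Parity of the number of inversions

module _ {n : ℕ} where

  _<ᶠ_ : Fin n → Fin n → Bool
  i <ᶠ j = does (toℕ i <? toℕ j)

  inverted : (Fin n → Fin n) → Fin n × Fin n → Bool
  inverted f (i , j) = (i <ᶠ j) ∧ (f j <ᶠ f i)

  allPairs : List (Fin n × Fin n)
  allPairs = concatMap (λ i → map (i ,_) (allFin n)) (allFin n)

  inversions≡count : ∀ (π : Permutation′ n) → inversions π ≡ count (inverted (π ⟨$⟩ʳ_)) allPairs
  inversions≡count π = trans (length-filter-count inv? (filter ordered? allPairs)) (count-filter ordered? _ allPairs)
    where
    ordered? inv? : Decidable {A = Fin n × Fin n} _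
    ordered? (i , j) = toℕ i <? toℕ j
    inv? (i , j) = toℕ (π ⟨$⟩ʳ j) <? toℕ (π ⟨$⟩ʳ i)

  inversions-cong : ∀ {π ρ : Permutation′ n} → π ≈ ρ → inversions π ≡ inversions ρ
  inversions-cong {π} {ρ} π≈ρ = begin
    inversions π                             ≡⟨ inversions≡count π ⟩
    count (inverted (π ⟨$⟩ʳ_)) allPairs      ≡⟨ count-cong (λ { (i , j) → cong₂ (λ x y → (i <ᶠ j) ∧ (x <ᶠ y)) (π≈ρ j) (π≈ρ i) })
                                                           allPairs ⟩
    count (inverted (ρ ⟨$⟩ʳ_)) allPairs      ≡⟨ inversions≡count ρ ⟨
    inversions ρ                             ∎
    where open ≡-Reasoning

  inversions-id : inversions (Perm.id {n}) ≡ 0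
  inversions-id = trans (inversions≡count Perm.id) (count-false (λ { (i , j) → asym i j }) allPairs)
    where
    asym : ∀ i j → (i <ᶠ j) ∧ (j <ᶠ i) ≡ false
    asym i j with <-cmp (toℕ i) (toℕ j)
    ... | tri< i<j _ _ = trans (cong (_∧ (j <ᶠ i)) (dec-true (toℕ i <? toℕ j) i<j)) (dec-false (toℕ j <? toℕ i) (<-asym i<j))
    ... | tri≈ i≮j _ _ = cong (_∧ (j <ᶠ i)) (dec-false (toℕ i <? toℕ j) i≮j)
    ... | tri> i≮j _ _ = cong (_∧ (j <ᶠ i)) (dec-false (toℕ i <? toℕ j) i≮j)

  count-allPairs-≟ : ∀ i₀ j₀ → count (λ p → does ((proj₁ p ≟ᶠ i₀) ×-dec (proj₂ p ≟ᶠ j₀))) allPairs ≡ 1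
  count-allPairs-≟ i₀ j₀ = trans (count-cartesianProduct (λ i → does (i ≟ᶠ i₀)) (λ j → does (j ≟ᶠ j₀)) (allFin n) (allFin n))
                                 (cong₂ _*_ (count-allFin-≟ i₀) (count-allFin-≟ j₀))

  module _ (π : Permutation′ n) {k k′ : Fin n} (k′≡1+k : toℕ k′ ≡ suc (toℕ k)) where
    private
      f g : Fin n → Fin n
      f = π ⟨$⟩ʳ_
      g = transpose k k′ ∘ f

      k<k′ : toℕ k < toℕ k′
      k<k′ = ≤-reflexive (sym k′≡1+k)

      <ᶠ-irrefl : ∀ x → (x <ᶠ x) ≡ false
      <ᶠ-irrefl x = dec-false (toℕ x <? toℕ x) (n≮n (toℕ x))

      <ᶠ-diag : ∀ (h : Fin n → Fin n) {x y} → x ≡ y → (h x <ᶠ h y) ≡ (x <ᶠ y)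
      <ᶠ-diag h {x} refl = trans (<ᶠ-irrefl (h x)) (sym (<ᶠ-irrefl x))

      <ᶠk≡<ᶠk′ : ∀ {x} → x ≢ k → (x <ᶠ k) ≡ (x <ᶠ k′)
      <ᶠk≡<ᶠk′ {x} x≢k = does-⇔ (mk⇔ (λ x<k → <-trans x<k k<k′) x<k′⇒x<k) (toℕ x <? toℕ k) (toℕ x <? toℕ k′)
        where
        x<k′⇒x<k : toℕ x < toℕ k′ → toℕ x < toℕ k
        x<k′⇒x<k x<k′ = ≤∧≢⇒< (s≤s⁻¹ (subst (toℕ x <_) k′≡1+k x<k′)) (x≢k ∘ toℕ-injective)

      k<ᶠ≡k′<ᶠ : ∀ {y} → y ≢ k′ → (k <ᶠ y) ≡ (k′ <ᶠ y)
      k<ᶠ≡k′<ᶠ {y} y≢k′ = does-⇔ (mk⇔ k<y⇒k′<y (<-trans k<k′)) (toℕ k <? toℕ y) (toℕ k′ <? toℕ y)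
        where
        k<y⇒k′<y : toℕ k < toℕ y → toℕ k′ < toℕ y
        k<y⇒k′<y k<y = ≤∧≢⇒< (subst (_≤ toℕ y) (sym k′≡1+k) k<y) (y≢k′ ∘ sym ∘ toℕ-injective)

      transpose-<ᶠ : ∀ x y → ¬ (x ≡ k × y ≡ k′) → ¬ (x ≡ k′ × y ≡ k) → (transpose k k′ x <ᶠ transpose k k′ y) ≡ (x <ᶠ y)
      transpose-<ᶠ x y ¬kk′ ¬k′k with transpose-view k k′ x | transpose-view k k′ y
      ... | at-i x≡k       | at-i y≡k       = <ᶠ-diag (transpose k k′) (trans x≡k (sym y≡k))
      ... | at-i x≡k       | at-j _ y≡k′    = ⊥-elim (¬kk′ (x≡k , y≡k′))
      ... | at-i x≡k       | other y≢k y≢k′ =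
        trans (cong₂ _<ᶠ_ (transpose-matchˡ x≡k) (transpose-other y≢k y≢k′)) (trans (sym (k<ᶠ≡k′<ᶠ y≢k′)) (cong (_<ᶠ y) (sym x≡k)))
      ... | at-j _ x≡k′    | at-i y≡k       = ⊥-elim (¬k′k (x≡k′ , y≡k))
      ... | at-j _ x≡k′    | at-j _ y≡k′    = <ᶠ-diag (transpose k k′) (trans x≡k′ (sym y≡k′))
      ... | at-j _ x≡k′    | other y≢k y≢k′ =
        trans (cong₂ _<ᶠ_ (transpose-matchʳ x≡k′) (transpose-other y≢k y≢k′)) (trans (k<ᶠ≡k′<ᶠ y≢k′) (cong (_<ᶠ y) (sym x≡k′)))
      ... | other x≢k x≢k′ | at-i y≡k       =
        trans (cong₂ _<ᶠ_ (transpose-other x≢k x≢k′) (transpose-matchˡ y≡k)) (trans (sym (<ᶠk≡<ᶠk′ x≢k)) (cong (x <ᶠ_) (sym y≡k)))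
      ... | other x≢k x≢k′ | at-j _ y≡k′    =
        trans (cong₂ _<ᶠ_ (transpose-other x≢k x≢k′) (transpose-matchʳ y≡k′)) (trans (<ᶠk≡<ᶠk′ x≢k) (cong (x <ᶠ_) (sym y≡k′)))
      ... | other x≢k x≢k′ | other y≢k y≢k′ = cong₂ _<ᶠ_ (transpose-other x≢k x≢k′) (transpose-other y≢k y≢k′)

      k<ᶠk′ : (k <ᶠ k′) ≡ true
      k<ᶠk′ = dec-true (toℕ k <? toℕ k′) k<k′

      k′<ᶠk : (k′ <ᶠ k) ≡ false
      k′<ᶠk = dec-false (toℕ k′ <? toℕ k) (<-asym k<k′)

      f-injective : ∀ {x y} → f x ≡ f y → x ≡ y
      f-injective = Injection.injective (↔⇒↣ π)

      Straddles : Fin n → Fin n → Set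
      Straddles i j = (f i ≡ k × f j ≡ k′) ⊎ (f i ≡ k′ × f j ≡ k)

      straddles? : ∀ i j → Dec (Straddles i j)
      straddles? i j = ((f i ≟ᶠ k) ×-dec (f j ≟ᶠ k′)) ⊎-dec ((f i ≟ᶠ k′) ×-dec (f j ≟ᶠ k))

      straddles-unique : ∀ {i j i′ j′} → Straddles i j → toℕ i < toℕ j → Straddles i′ j′ → toℕ i′ < toℕ j′ →
                         i ≡ i′ × j ≡ j′
      straddles-unique (inj₁ (fi , fj)) _ (inj₁ (fi′ , fj′)) _ = f-injective (trans fi (sym fi′)) , f-injective (trans fj (sym fj′))
      straddles-unique (inj₂ (fi , fj)) _ (inj₂ (fi′ , fj′)) _ = f-injective (trans fi (sym fi′)) , f-injective (trans fj (sym fj′))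
      straddles-unique (inj₁ (fi , fj)) i<j (inj₂ (fi′ , fj′)) i′<j′ =
        ⊥-elim (<-asym i<j (subst₂ (λ a b → toℕ a < toℕ b) (f-injective (trans fi′ (sym fj))) (f-injective (trans fj′ (sym fi))) i′<j′))
      straddles-unique (inj₂ (fi , fj)) i<j (inj₁ (fi′ , fj′)) i′<j′ =
        ⊥-elim (<-asym i<j (subst₂ (λ a b → toℕ a < toℕ b) (f-injective (trans fi′ (sym fj))) (f-injective (trans fj′ (sym fi))) i′<j′))

      straddling-pair : ∃₂ λ i₀ j₀ → toℕ i₀ < toℕ j₀ × Straddles i₀ j₀
      straddling-pair with <-cmp (toℕ (π ⟨$⟩ˡ k)) (toℕ (π ⟨$⟩ˡ k′))
      ... | tri< u<u′ _ _ = _ , _ , u<u′ , inj₁ (inverseʳ π , inverseʳ π)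
      ... | tri> _ _ u′<u = _ , _ , u′<u , inj₂ (inverseʳ π , inverseʳ π)
      ... | tri≈ _ u≡u′ _ = ⊥-elim (<⇒≢ k<k′ (cong toℕ (trans (sym (inverseʳ π)) (trans (cong f (toℕ-injective u≡u′)) (inverseʳ π)))))

      flips : ∀ i j → (f j <ᶠ f i) xor (g j <ᶠ g i) ≡ does (straddles? i j)
      flips i j = flips′ (straddles? i j)
        where
        flips′ : (s? : Dec (Straddles i j)) → (f j <ᶠ f i) xor (g j <ᶠ g i) ≡ does s?
        flips′ (yes (inj₁ (fi≡k , fj≡k′))) =
          cong₂ _xor_ (trans (cong₂ _<ᶠ_ fj≡k′ fi≡k) k′<ᶠk) (trans (cong₂ _<ᶠ_ (transpose-matchʳ fj≡k′) (transpose-matchˡ fi≡k)) k<ᶠk′)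
        flips′ (yes (inj₂ (fi≡k′ , fj≡k))) =
          cong₂ _xor_ (trans (cong₂ _<ᶠ_ fj≡k fi≡k′) k<ᶠk′) (trans (cong₂ _<ᶠ_ (transpose-matchˡ fj≡k) (transpose-matchʳ fi≡k′)) k′<ᶠk)
        flips′ (no ¬s) =
          trans (cong ((f j <ᶠ f i) xor_) (transpose-<ᶠ (f j) (f i) (¬s ∘ inj₂ ∘ swap) (¬s ∘ inj₁ ∘ swap))) (xor-same (f j <ᶠ f i))

      count-inverted-xor : count (λ p → inverted f p xor inverted g p) allPairs ≡ 1
      count-inverted-xor with straddling-pair
      ... | i₀ , j₀ , i₀<j₀ , s₀ = trans (count-cong changed allPairs) (count-allPairs-≟ i₀ j₀)
        where
        changed : ∀ p → inverted f p xor inverted g p ≡ does ((proj₁ p ≟ᶠ i₀) ×-dec (proj₂ p ≟ᶠ j₀))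
        changed (i , j) = begin
          inverted f (i , j) xor inverted g (i , j)
            ≡⟨ ∧-distribˡ-xor (i <ᶠ j) _ _ ⟨
          (i <ᶠ j) ∧ ((f j <ᶠ f i) xor (g j <ᶠ g i))
            ≡⟨ cong ((i <ᶠ j) ∧_) (flips i j) ⟩
          does ((toℕ i <? toℕ j) ×-dec straddles? i j)
            ≡⟨ does-⇔ (mk⇔ is-pair₀ pair₀-is) ((toℕ i <? toℕ j) ×-dec straddles? i j) ((i ≟ᶠ i₀) ×-dec (j ≟ᶠ j₀)) ⟩
          does ((i ≟ᶠ i₀) ×-dec (j ≟ᶠ j₀)) ∎
          where
          open ≡-Reasoning
          is-pair₀ : toℕ i < toℕ j × Straddles i j → i ≡ i₀ × j ≡ j₀
          is-pair₀ (i<j , s) = straddles-unique s i<j s₀ i₀<j₀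
          pair₀-is : i ≡ i₀ × j ≡ j₀ → toℕ i < toℕ j × Straddles i j
          pair₀-is (refl , refl) = i₀<j₀ , s₀

    inversions-∘ₚ-transpose-adjacent : parity (inversions (π ∘ₚ transposeₚ k k′)) ≡ parity (inversions π) ⁻¹
    inversions-∘ₚ-transpose-adjacent = begin
      parity (inversions (π ∘ₚ transposeₚ k k′))     ≡⟨ cong parity (inversions≡count (π ∘ₚ transposeₚ k k′)) ⟩
      parity (count (inverted g) allPairs)           ≡⟨ +≡1ℙ⇒≡⁻¹ (parity (count (inverted f) allPairs)) _ sum≡1ℙ ⟩
      parity (count (inverted f) allPairs) ⁻¹        ≡⟨ cong (λ c → parity c ⁻¹) (inversions≡count π) ⟨
      parity (inversions π) ⁻¹                       ∎
      where
      open ≡-Reasoning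
      sum≡1ℙ : parity (count (inverted f) allPairs) ℙ.+ parity (count (inverted g) allPairs) ≡ 1ℙ
      sum≡1ℙ = trans (parity-count-xor (inverted f) (inverted g) allPairs) (cong parity count-inverted-xor)

  private
    inversions-∘ₚ-transpose-at : ∀ d (π : Permutation′ n) {i j : Fin n} → toℕ j ≡ suc (d + toℕ i) →
                                 parity (inversions (π ∘ₚ transposeₚ i j)) ≡ parity (inversions π) ⁻¹
    inversions-∘ₚ-transpose-at zero    π j≡1+i = inversions-∘ₚ-transpose-adjacent π j≡1+i
    inversions-∘ₚ-transpose-at (suc d) π {i} {j} j≡2+d+i = begin
      parity (inversions (π ∘ₚ transposeₚ i j))
        ≡⟨ cong parity (inversions-cong {π ∘ₚ transposeₚ i j} {(π′ ∘ₚ transposeₚ i j′) ∘ₚ τ} conjugated) ⟩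
      parity (inversions ((π′ ∘ₚ transposeₚ i j′) ∘ₚ τ))
        ≡⟨ inversions-∘ₚ-transpose-adjacent (π′ ∘ₚ transposeₚ i j′) j≡1+j′ ⟩
      parity (inversions (π′ ∘ₚ transposeₚ i j′)) ⁻¹
        ≡⟨ cong _⁻¹ (inversions-∘ₚ-transpose-at d π′ j′≡1+d+i) ⟩
      parity (inversions π′) ⁻¹ ⁻¹
        ≡⟨ ⁻¹-involutive _ ⟩
      parity (inversions π′)
        ≡⟨ inversions-∘ₚ-transpose-adjacent π j≡1+j′ ⟩
      parity (inversions π) ⁻¹ ∎
      where
      open ≡-Reasoning
      j′<n : suc (d + toℕ i) < n
      j′<n = <-trans (subst (suc (d + toℕ i) <_) (sym j≡2+d+i) ≤-refl) (toℕ<n j)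
      j′ : Fin n
      j′ = fromℕ< j′<n
      j′≡1+d+i : toℕ j′ ≡ suc (d + toℕ i)
      j′≡1+d+i = toℕ-fromℕ< j′<n
      j≡1+j′ : toℕ j ≡ suc (toℕ j′)
      j≡1+j′ = trans j≡2+d+i (cong suc (sym j′≡1+d+i))
      τ π′ : Permutation′ n
      τ = transposeₚ j′ j
      π′ = π ∘ₚ τ
      i≢j′ : i ≢ j′
      i≢j′ i≡j′ = <⇒≢ (s≤s (m≤n+m (toℕ i) d)) (trans (cong toℕ i≡j′) j′≡1+d+i)
      i≢j : i ≢ j
      i≢j i≡j = <⇒≢ (s≤s (m≤n+m (toℕ i) (suc d))) (trans (cong toℕ i≡j) j≡2+d+i)
      conjugated : π ∘ₚ transposeₚ i j ≈ (π′ ∘ₚ transposeₚ i j′) ∘ₚ τ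
      conjugated x = sym (begin
        transpose j′ j (transpose i j′ (transpose j′ j y))
          ≡⟨ transpose-conjugate (transpose j′ j) (transpose j′ j) (transpose-involutive j′ j) (transpose-involutive j′ j) i j′ y ⟩
        transpose (transpose j′ j i) (transpose j′ j j′) y
          ≡⟨ cong₂ (λ a b → transpose a b y) (transpose-other i≢j′ i≢j) (transpose-matchˡ {j = j} (refl {x = j′})) ⟩
        transpose i j y ∎)
        where
        y : Fin n
        y = π ⟨$⟩ʳ x

  inversions-∘ₚ-transpose : ∀ (π : Permutation′ n) {i j : Fin n} → i ≢ j →
                            parity (inversions (π ∘ₚ transposeₚ i j)) ≡ parity (inversions π) ⁻¹
  inversions-∘ₚ-transpose π {i} {j} i≢j with <-cmp (toℕ i) (toℕ j)
  ... | tri< i<j _ _ = inversions-∘ₚ-transpose-at (toℕ j ∸ suc (toℕ i)) π (sym (trans (sym (+-suc _ (toℕ i))) (m∸n+n≡m i<j)))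
  ... | tri≈ _ i≡j _ = ⊥-elim (i≢j (toℕ-injective i≡j))
  ... | tri> _ _ j<i = trans (cong parity (inversions-cong {π ∘ₚ transposeₚ i j} {π ∘ₚ transposeₚ j i} (λ x → transpose-comm i j (π ⟨$⟩ʳ x))))
                             (inversions-∘ₚ-transpose-at (toℕ i ∸ suc (toℕ j)) π (sym (trans (sym (+-suc _ (toℕ j))) (m∸n+n≡m j<i))))

  inversions-transpose : ∀ {i j : Fin n} → i ≢ j → parity (inversions (transposeₚ i j)) ≡ 1ℙ
  inversions-transpose i≢j = trans (inversions-∘ₚ-transpose Perm.id i≢j) (cong (λ c → parity c ⁻¹) inversions-id)

  PreservesParity : Permutation′ n → Set
  PreservesParity ρ = ∀ π → parity (inversions (π ∘ₚ ρ)) ≡ parity (inversions π)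

  preservesParity-∘ₚ : ∀ {ρ ρ′} → PreservesParity ρ → PreservesParity ρ′ → PreservesParity (ρ ∘ₚ ρ′)
  preservesParity-∘ₚ {ρ} even-ρ even-ρ′ π = trans (even-ρ′ (π ∘ₚ ρ)) (even-ρ π)

  preservesParity-transpose² : ∀ {ρ i j k l} → i ≢ j → k ≢ l → (∀ x → ρ ⟨$⟩ʳ x ≡ transpose i j (transpose k l x)) →
                               PreservesParity ρ
  preservesParity-transpose² {ρ} {i} {j} {k} {l} i≢j k≢l ρ≗ττ π = begin
    parity (inversions (π ∘ₚ ρ))
      ≡⟨ cong parity (inversions-cong {π ∘ₚ ρ} {(π ∘ₚ transposeₚ k l) ∘ₚ transposeₚ i j} (ρ≗ττ ∘ (π ⟨$⟩ʳ_))) ⟩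
    parity (inversions ((π ∘ₚ transposeₚ k l) ∘ₚ transposeₚ i j))
      ≡⟨ inversions-∘ₚ-transpose (π ∘ₚ transposeₚ k l) i≢j ⟩
    parity (inversions (π ∘ₚ transposeₚ k l)) ⁻¹
      ≡⟨ cong _⁻¹ (inversions-∘ₚ-transpose π k≢l) ⟩
    parity (inversions π) ⁻¹ ⁻¹
      ≡⟨ ⁻¹-involutive _ ⟩
    parity (inversions π) ∎
    where open ≡-Reasoning

  fixes-all-but-two : ∀ (π : Permutation′ n) {p q} → p ≢ q → (∀ x → x ≢ p → x ≢ q → π ⟨$⟩ʳ x ≡ x) →
                      π ≈ Perm.id ⊎ π ≈ transposeₚ p q
  fixes-all-but-two π {p} {q} p≢q fixed = cases (f p ≟ᶠ p) (f p ≟ᶠ q)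
    where
    f : Fin n → Fin n
    f = π ⟨$⟩ʳ_

    f-injective : ∀ {x y} → f x ≡ f y → x ≡ y
    f-injective = Injection.injective (↔⇒↣ π)

    f-fixed : ∀ z → f z ≢ p → f z ≢ q → f z ≡ z
    f-fixed z fz≢p fz≢q = f-injective (fixed (f z) fz≢p fz≢q)

    fq≡q : f p ≡ p → f q ≡ q
    fq≡q fp≡p with f q ≟ᶠ q
    ... | yes fq≡q = fq≡q
    ... | no fq≢q  = f-fixed q (λ fq≡p → p≢q (f-injective (trans fp≡p (sym fq≡p)))) fq≢q

    fq≡p : f p ≡ q → f q ≡ p
    fq≡p fp≡q with f q ≟ᶠ p
    ... | yes fq≡p = fq≡p
    ... | no fq≢p  = ⊥-elim (p≢q (f-injective (trans fp≡q (sym (f-fixed q fq≢p fq≢q)))))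
      where
      fq≢q : f q ≢ q
      fq≢q fq≡q = p≢q (f-injective (trans fp≡q (sym fq≡q)))

    cases : Dec (f p ≡ p) → Dec (f p ≡ q) → π ≈ Perm.id ⊎ π ≈ transposeₚ p q
    cases (yes fp≡p) _ = inj₁ λ x → case transpose-view p q x of λ where
      (at-i x≡p)      → trans (cong f x≡p) (trans fp≡p (sym x≡p))
      (at-j _ x≡q)    → trans (cong f x≡q) (trans (fq≡q fp≡p) (sym x≡q))
      (other x≢p x≢q) → fixed x x≢p x≢q
    cases (no fp≢p) (yes fp≡q) = inj₂ λ x → case transpose-view p q x of λ where
      (at-i x≡p)      → trans (cong f x≡p) (trans fp≡q (sym (transpose-matchˡ x≡p)))
      (at-j _ x≡q)    → trans (cong f x≡q) (trans (fq≡p fp≡q) (sym (transpose-matchʳ x≡q)))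
      (other x≢p x≢q) → trans (fixed x x≢p x≢q) (sym (transpose-other x≢p x≢q))
    cases (no fp≢p) (no fp≢q) = ⊥-elim (fp≢p (f-fixed p fp≢p fp≢q))

-- Words in the shifts

inverseShift : Shift → Shift
inverseShift α   = α⁻¹
inverseShift α⁻¹ = α
inverseShift β   = β⁻¹
inverseShift β⁻¹ = β

inverseShift-involutive : ∀ s → inverseShift (inverseShift s) ≡ s
inverseShift-involutive α   = refl
inverseShift-involutive α⁻¹ = refl
inverseShift-involutive β   = refl
inverseShift-involutive β⁻¹ = refl

inverse : List Shift → List Shift
inverse = reverse ∘ map inverseShift

length-inverse : ∀ ws → length (inverse ws) ≡ length ws
length-inverse ws = trans (length-reverse (map inverseShift ws)) (length-map inverseShift ws)

inverse-involutive : ∀ ws → inverse (inverse ws) ≡ ws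
inverse-involutive ws = begin
  reverse (map inverseShift (reverse (map inverseShift ws)))   ≡⟨ cong reverse (reverse-map inverseShift (map inverseShift ws)) ⟩
  reverse (reverse (map inverseShift (map inverseShift ws)))   ≡⟨ reverse-involutive _ ⟩
  map inverseShift (map inverseShift ws)                       ≡⟨ map-∘ ws ⟨
  map (inverseShift ∘ inverseShift) ws                         ≡⟨ map-cong inverseShift-involutive ws ⟩
  map id ws                                                    ≡⟨ map-id ws ⟩
  ws                                                           ∎
  where open ≡-Reasoning

module Puzzle (a' b' : ℕ) where

  n : ℕ
  n = puzzleN a' b'

  -- The same proof term as in the definition of applyShift, so that β and β⁻¹ are recognised definitionally.
  β-bounds : 2 + a' ≤ 6 + a' + b'
  β-bounds = s≤s (s≤s (≤-trans (m≤n+m a' 4) (m≤m+n (4 + a') b')))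

  inverseShift-applyShift : ∀ s x → applyShift a' b' (inverseShift s) (applyShift a' b' s x) ≡ x
  inverseShift-applyShift α   x = cycleBwd-cycleFwd 0 (3 + a') z≤n _ x
  inverseShift-applyShift α⁻¹ x = cycleFwd-cycleBwd 0 (3 + a') z≤n _ x
  inverseShift-applyShift β   x = cycleBwd-cycleFwd (2 + a') (6 + a' + b') β-bounds ≤-refl x
  inverseShift-applyShift β⁻¹ x = cycleFwd-cycleBwd (2 + a') (6 + a' + b') β-bounds ≤-refl x

  -- Opaque, so that a word is matched letter by letter rather than unfolded into nested cycles.
  opaque
    ⟦_⟧ : List Shift → Fin n → Fin n
    ⟦_⟧ = runShifts a' b'

    ⟦⟧≡runShifts : ∀ ws x → ⟦ ws ⟧ x ≡ runShifts a' b' ws x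
    ⟦⟧≡runShifts ws x = refl

    ⟦⟧-[] : ∀ {x} → ⟦ [] ⟧ x ≡ x
    ⟦⟧-[] = refl

    ⟦⟧-∷ : ∀ {s ws x} → ⟦ s ∷ ws ⟧ x ≡ applyShift a' b' s (⟦ ws ⟧ x)
    ⟦⟧-∷ = refl

    ⟦⟧-++ : ∀ ws vs x → ⟦ ws ++ vs ⟧ x ≡ ⟦ ws ⟧ (⟦ vs ⟧ x)
    ⟦⟧-++ []       vs x = refl
    ⟦⟧-++ (s ∷ ws) vs x = cong (applyShift a' b' s) (⟦⟧-++ ws vs x)

    ⟦inverse⟧-⟦⟧ : ∀ ws x → ⟦ inverse ws ⟧ (⟦ ws ⟧ x) ≡ x
    ⟦inverse⟧-⟦⟧ []       x = refl
    ⟦inverse⟧-⟦⟧ (s ∷ ws) x = begin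
      ⟦ inverse (s ∷ ws) ⟧ (⟦ s ∷ ws ⟧ x)
        ≡⟨ cong (λ w → ⟦ w ⟧ (⟦ s ∷ ws ⟧ x)) (unfold-reverse (inverseShift s) (map inverseShift ws)) ⟩
      ⟦ inverse ws ++ [ inverseShift s ] ⟧ (⟦ s ∷ ws ⟧ x)
        ≡⟨ ⟦⟧-++ (inverse ws) [ inverseShift s ] _ ⟩
      ⟦ inverse ws ⟧ (⟦ inverseShift s ∷ s ∷ ws ⟧ x)
        ≡⟨ cong ⟦ inverse ws ⟧ (inverseShift-applyShift s _) ⟩
      ⟦ inverse ws ⟧ (⟦ ws ⟧ x)
        ≡⟨ ⟦inverse⟧-⟦⟧ ws x ⟩
      x ∎
      where open ≡-Reasoning

  ⟦⟧-⟦inverse⟧ : ∀ ws x → ⟦ ws ⟧ (⟦ inverse ws ⟧ x) ≡ x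
  ⟦⟧-⟦inverse⟧ ws x = subst (λ w → ⟦ w ⟧ (⟦ inverse ws ⟧ x) ≡ x) (inverse-involutive ws) (⟦inverse⟧-⟦⟧ (inverse ws) x)

  ⟦_⟧ₚ : List Shift → Permutation′ n
  ⟦ ws ⟧ₚ = permutation ⟦ ws ⟧ ⟦ inverse ws ⟧ (⟦⟧-⟦inverse⟧ ws) (⟦inverse⟧-⟦⟧ ws)

  preservesParity-[] : PreservesParity ⟦ [] ⟧ₚ
  preservesParity-[] π = cong parity (inversions-cong {π = π ∘ₚ ⟦ [] ⟧ₚ} {ρ = π} (λ x → ⟦⟧-[]))

  preservesParity-++ : ∀ w v → PreservesParity ⟦ w ⟧ₚ → PreservesParity ⟦ v ⟧ₚ → PreservesParity ⟦ w ++ v ⟧ₚ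
  preservesParity-++ w v even-w even-v π = begin
    parity (inversions (π ∘ₚ ⟦ w ++ v ⟧ₚ))
      ≡⟨ cong parity (inversions-cong {π = π ∘ₚ ⟦ w ++ v ⟧ₚ} {ρ = (π ∘ₚ ⟦ v ⟧ₚ) ∘ₚ ⟦ w ⟧ₚ} (λ x → ⟦⟧-++ w v _)) ⟩
    parity (inversions ((π ∘ₚ ⟦ v ⟧ₚ) ∘ₚ ⟦ w ⟧ₚ))
      ≡⟨ preservesParity-∘ₚ {ρ = ⟦ v ⟧ₚ} {ρ′ = ⟦ w ⟧ₚ} even-v even-w π ⟩
    parity (inversions π) ∎
    where open ≡-Reasoning

  Realises : List Shift → Fin n → Fin n → Fin n → Fin n → Set
  Realises w i j k l = ∀ x → ⟦ w ⟧ x ≡ transpose i j (transpose k l x)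

  conjugate : List Shift → List Shift → List Shift
  conjugate g w = g ++ w ++ inverse g

  realises-conjugate : ∀ g {w i j k l} → Realises w i j k l →
                       Realises (conjugate g w) (⟦ g ⟧ i) (⟦ g ⟧ j) (⟦ g ⟧ k) (⟦ g ⟧ l)
  realises-conjugate g {w} {i} {j} {k} {l} w≗ττ x = begin
    ⟦ conjugate g w ⟧ x                            ≡⟨ trans (⟦⟧-++ g _ x) (cong G (⟦⟧-++ w (inverse g) x)) ⟩
    G (⟦ w ⟧ (G⁻¹ x))                              ≡⟨ cong G (w≗ττ (G⁻¹ x)) ⟩
    G (transpose i j (transpose k l (G⁻¹ x)))      ≡⟨ cong (G ∘ transpose i j) (⟦inverse⟧-⟦⟧ g _) ⟨
    G (transpose i j (G⁻¹ (G (transpose k l (G⁻¹ x))))) ≡⟨ conj i j _ ⟩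
    transpose (G i) (G j) (G (transpose k l (G⁻¹ x))) ≡⟨ cong (transpose (G i) (G j)) (conj k l x) ⟩
    transpose (G i) (G j) (transpose (G k) (G l) x) ∎
    where
    open ≡-Reasoning
    G G⁻¹ : Fin n → Fin n
    G = ⟦ g ⟧
    G⁻¹ = ⟦ inverse g ⟧
    conj : ∀ i j x → G (transpose i j (G⁻¹ x)) ≡ transpose (G i) (G j) x
    conj = transpose-conjugate G G⁻¹ (⟦⟧-⟦inverse⟧ g) (⟦inverse⟧-⟦⟧ g)

  realises-inverse-++ : ∀ {w₁ w₂ i j k l k′ l′} → Realises w₁ i j k l → Realises w₂ i j k′ l′ →
                        Realises (inverse w₁ ++ w₂) k l k′ l′
  realises-inverse-++ {w₁} {w₂} {i} {j} {k} {l} {k′} {l′} w₁≗ττ w₂≗ττ x = begin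
    ⟦ inverse w₁ ++ w₂ ⟧ x
      ≡⟨ ⟦⟧-++ (inverse w₁) w₂ x ⟩
    ⟦ inverse w₁ ⟧ (⟦ w₂ ⟧ x)
      ≡⟨ cong ⟦ inverse w₁ ⟧ (w₂≗ττ x) ⟩
    ⟦ inverse w₁ ⟧ (transpose i j (transpose k′ l′ x))
      ≡⟨ cong (⟦ inverse w₁ ⟧ ∘ transpose i j) (transpose-involutive k l (transpose k′ l′ x)) ⟨
    ⟦ inverse w₁ ⟧ (transpose i j (transpose k l y))
      ≡⟨ cong ⟦ inverse w₁ ⟧ (w₁≗ττ y) ⟨
    ⟦ inverse w₁ ⟧ (⟦ w₁ ⟧ y)
      ≡⟨ ⟦inverse⟧-⟦⟧ w₁ y ⟩
    transpose k l (transpose k′ l′ x) ∎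
    where
    open ≡-Reasoning
    y : Fin n
    y = transpose k l (transpose k′ l′ x)

  realises-++ : ∀ {w w′ i j k l k′ l′} → Realises w i j k l → Realises w′ i j k′ l′ →
                k ≢ i → k ≢ j → l ≢ i → l ≢ j → Realises (w ++ w′) k l k′ l′
  realises-++ {w} {w′} {i} {j} {k} {l} {k′} {l′} w≗ττ w′≗ττ k≢i k≢j l≢i l≢j x = begin
    ⟦ w ++ w′ ⟧ x
      ≡⟨ ⟦⟧-++ w w′ x ⟩
    ⟦ w ⟧ (⟦ w′ ⟧ x)
      ≡⟨ trans (w≗ττ _) (cong (transpose i j ∘ transpose k l) (w′≗ττ x)) ⟩
    transpose i j (transpose k l (transpose i j y))
      ≡⟨ transpose-conjugate τ τ (transpose-involutive i j) (transpose-involutive i j) k l y ⟩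
    transpose (τ k) (τ l) y
      ≡⟨ cong₂ (λ u v → transpose u v y) (transpose-other k≢i k≢j) (transpose-other l≢i l≢j) ⟩
    transpose k l y ∎
    where
    open ≡-Reasoning
    τ : Fin n → Fin n
    τ = transpose i j
    y : Fin n
    y = transpose k′ l′ x

  realises-preservesParity : ∀ {w i j k l} → i ≢ j → k ≢ l → Realises w i j k l → PreservesParity ⟦ w ⟧ₚ
  realises-preservesParity {w} i≢j k≢l w≗ττ = preservesParity-transpose² {ρ = ⟦ w ⟧ₚ} i≢j k≢l w≗ττ

  start : ∀ {x k} → toℕ x ≡ k → toℕ (⟦ [] ⟧ x) ≡ k
  start = trans (cong toℕ ⟦⟧-[])

  α-step : ∀ {ws x k} → toℕ (⟦ ws ⟧ x) ≡ k → k < 3 + a' → toℕ (⟦ α ∷ ws ⟧ x) ≡ suc k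
  α-step x≡k k<r = trans (cong toℕ ⟦⟧-∷) (cycleFwd-inside 0 (3 + a') z≤n _ x≡k z≤n k<r)

  α-wrap : ∀ {ws x} → toℕ (⟦ ws ⟧ x) ≡ 3 + a' → toℕ (⟦ α ∷ ws ⟧ x) ≡ 0
  α-wrap x≡r = trans (cong toℕ ⟦⟧-∷) (cycleFwd-last 0 (3 + a') z≤n _ x≡r)

  α-fix : ∀ {ws x k} → toℕ (⟦ ws ⟧ x) ≡ k → 3 + a' < k → toℕ (⟦ α ∷ ws ⟧ x) ≡ k
  α-fix x≡k r<k = trans (cong toℕ ⟦⟧-∷) (cycleFwd-above 0 (3 + a') z≤n _ x≡k r<k)

  α⁻¹-step : ∀ {ws x k} → toℕ (⟦ ws ⟧ x) ≡ suc k → k < 3 + a' → toℕ (⟦ α⁻¹ ∷ ws ⟧ x) ≡ k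
  α⁻¹-step x≡1+k k<r = trans (cong toℕ ⟦⟧-∷) (cycleBwd-inside 0 (3 + a') z≤n _ x≡1+k z≤n k<r)

  α⁻¹-wrap : ∀ {ws x} → toℕ (⟦ ws ⟧ x) ≡ 0 → toℕ (⟦ α⁻¹ ∷ ws ⟧ x) ≡ 3 + a'
  α⁻¹-wrap x≡0 = trans (cong toℕ ⟦⟧-∷) (cycleBwd-first 0 (3 + a') z≤n _ x≡0)

  α⁻¹-fix : ∀ {ws x k} → toℕ (⟦ ws ⟧ x) ≡ k → 3 + a' < k → toℕ (⟦ α⁻¹ ∷ ws ⟧ x) ≡ k
  α⁻¹-fix x≡k r<k = trans (cong toℕ ⟦⟧-∷) (cycleBwd-above 0 (3 + a') z≤n _ x≡k r<k)

  β-fix : ∀ {ws x k} → toℕ (⟦ ws ⟧ x) ≡ k → k < 2 + a' → toℕ (⟦ β ∷ ws ⟧ x) ≡ k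
  β-fix x≡k k<l = trans (cong toℕ ⟦⟧-∷) (cycleFwd-below (2 + a') (6 + a' + b') β-bounds ≤-refl x≡k k<l)

  β-step : ∀ {ws x k} → toℕ (⟦ ws ⟧ x) ≡ k → 2 + a' ≤ k → k < 6 + a' + b' → toℕ (⟦ β ∷ ws ⟧ x) ≡ suc k
  β-step x≡k l≤k k<r = trans (cong toℕ ⟦⟧-∷) (cycleFwd-inside (2 + a') (6 + a' + b') β-bounds ≤-refl x≡k l≤k k<r)

  β-wrap : ∀ {ws x} → toℕ (⟦ ws ⟧ x) ≡ 6 + a' + b' → toℕ (⟦ β ∷ ws ⟧ x) ≡ 2 + a'
  β-wrap x≡r = trans (cong toℕ ⟦⟧-∷) (cycleFwd-last (2 + a') (6 + a' + b') β-bounds ≤-refl x≡r)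

  β⁻¹-fix : ∀ {ws x k} → toℕ (⟦ ws ⟧ x) ≡ k → k < 2 + a' → toℕ (⟦ β⁻¹ ∷ ws ⟧ x) ≡ k
  β⁻¹-fix x≡k k<l = trans (cong toℕ ⟦⟧-∷) (cycleBwd-below (2 + a') (6 + a' + b') β-bounds ≤-refl x≡k k<l)

  β⁻¹-step : ∀ {ws x k} → toℕ (⟦ ws ⟧ x) ≡ suc k → 2 + a' ≤ k → k < 6 + a' + b' → toℕ (⟦ β⁻¹ ∷ ws ⟧ x) ≡ k
  β⁻¹-step x≡1+k l≤k k<r = trans (cong toℕ ⟦⟧-∷) (cycleBwd-inside (2 + a') (6 + a' + b') β-bounds ≤-refl x≡1+k l≤k k<r)

  β⁻¹-wrap : ∀ {ws x} → toℕ (⟦ ws ⟧ x) ≡ 2 + a' → toℕ (⟦ β⁻¹ ∷ ws ⟧ x) ≡ 6 + a' + b'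
  β⁻¹-wrap x≡l = trans (cong toℕ ⟦⟧-∷) (cycleBwd-first (2 + a') (6 + a' + b') β-bounds ≤-refl x≡l)

  -- pₖ is the point at position k, counted from 0, and a = 4 + a'.
  opaque
    point : ∀ c {c≤6 : T (c ≤ᵇ 6)} → Fin n
    point c {c≤6} = fromℕ< (s≤s (m≤n⇒m≤n+o b' (+-monoˡ-≤ a' (≤ᵇ⇒≤ c 6 c≤6))))

    toℕ-point : ∀ c {c≤6 : T (c ≤ᵇ 6)} → toℕ (point c {c≤6}) ≡ c + a'
    toℕ-point c = toℕ-fromℕ< _

    p₀ pₙ₋₁ pₐ₋₄ pₐ₋₃ pₐ₋₂ pₐ₋₁ pₐ pₐ₊₁ : Fin n
    p₀   = fromℕ< {0} (s≤s z≤n)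
    pₙ₋₁ = fromℕ< {6 + a' + b'} ≤-refl
    pₐ₋₄ = point 0
    pₐ₋₃ = point 1
    pₐ₋₂ = point 2
    pₐ₋₁ = point 3
    pₐ   = point 4
    pₐ₊₁ = point 5

    toℕ-p₀ : toℕ p₀ ≡ 0
    toℕ-p₀ = refl
    toℕ-pₙ₋₁ : toℕ pₙ₋₁ ≡ 6 + a' + b'
    toℕ-pₙ₋₁ = toℕ-fromℕ< ≤-refl
    toℕ-pₐ₋₄ : toℕ pₐ₋₄ ≡ a'
    toℕ-pₐ₋₄ = toℕ-point 0
    toℕ-pₐ₋₃ : toℕ pₐ₋₃ ≡ 1 + a'
    toℕ-pₐ₋₃ = toℕ-point 1
    toℕ-pₐ₋₂ : toℕ pₐ₋₂ ≡ 2 + a'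
    toℕ-pₐ₋₂ = toℕ-point 2
    toℕ-pₐ₋₁ : toℕ pₐ₋₁ ≡ 3 + a'
    toℕ-pₐ₋₁ = toℕ-point 3
    toℕ-pₐ : toℕ pₐ ≡ 4 + a'
    toℕ-pₐ = toℕ-point 4
    toℕ-pₐ₊₁ : toℕ pₐ₊₁ ≡ 5 + a'
    toℕ-pₐ₊₁ = toℕ-point 5

  ≡-by-toℕ : ∀ {x y : Fin n} {k} → toℕ x ≡ k → toℕ y ≡ k → x ≡ y
  ≡-by-toℕ x≡k y≡k = toℕ-injective (trans x≡k (sym y≡k))

  ≢-by-toℕ : ∀ {x y : Fin n} {k m} → toℕ x ≡ k → toℕ y ≡ m → k ≢ m → x ≢ y
  ≢-by-toℕ x≡k y≡m k≢m x≡y = k≢m (trans (sym x≡k) (trans (cong toℕ x≡y) y≡m))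

  <last : ∀ {k} → k < 6 + a' → k < 6 + a' + b'
  <last = m≤n⇒m≤n+o b'

  commutator : List Shift
  commutator = α ∷ β ∷ α⁻¹ ∷ β⁻¹ ∷ []

  private
    data CommutatorRegion (v : ℕ) : Set where
      at-0   : v ≡ 0 → CommutatorRegion v
      in-α   : ∀ w → v ≡ suc w → w < 1 + a' → CommutatorRegion v
      at-a-2 : v ≡ 2 + a' → CommutatorRegion v
      at-a-1 : v ≡ 3 + a' → CommutatorRegion v
      at-a   : v ≡ 4 + a' → CommutatorRegion v
      in-β   : ∀ w → v ≡ suc w → 4 + a' ≤ w → CommutatorRegion v

    commutatorRegion : ∀ v → CommutatorRegion v
    commutatorRegion zero = at-0 refl
    commutatorRegion (suc w) with <-cmp w (1 + a')
    ... | tri< w<1+a' _ _ = in-α w refl w<1+a'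
    ... | tri≈ _ w≡1+a' _ = at-a-2 (cong suc w≡1+a')
    ... | tri> _ _ 1+a'<w with <-cmp w (3 + a')
    ...   | tri< w<3+a' _ _ = at-a-1 (cong suc (≤-antisym (s≤s⁻¹ w<3+a') 1+a'<w))
    ...   | tri≈ _ w≡3+a' _ = at-a (cong suc w≡3+a')
    ...   | tri> _ _ 3+a'<w = in-β w refl 3+a'<w

  commutator-realises : Realises commutator p₀ pₐ pₐ₋₂ pₐ₋₁
  commutator-realises x with commutatorRegion (toℕ x)
  ... | at-0 x≡0 = trans (≡-by-toℕ lhs toℕ-pₐ) (sym rhs)
    where
    lhs : toℕ (⟦ commutator ⟧ x) ≡ 4 + a'
    lhs = α-fix (β-step (α⁻¹-wrap (β⁻¹-fix (start x≡0) (s≤s z≤n))) (m≤n+m _ 1) (<last (m≤n+m _ 2))) ≤-refl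
    rhs : transpose p₀ pₐ (transpose pₐ₋₂ pₐ₋₁ x) ≡ pₐ
    rhs = trans (cong (transpose p₀ pₐ) (transpose-other (≢-by-toℕ x≡0 toℕ-pₐ₋₂ λ ()) (≢-by-toℕ x≡0 toℕ-pₐ₋₁ λ ())))
                (transpose-matchˡ (≡-by-toℕ x≡0 toℕ-p₀))
  ... | in-α w x≡1+w w<1+a' = trans (toℕ-injective (trans lhs (sym x≡1+w))) (sym (transpose²-other
          (≢-by-toℕ x≡1+w toℕ-p₀ λ ()) (≢-by-toℕ x≡1+w toℕ-pₐ (<⇒≢ (≤-trans (s≤s w<1+a') (m≤n+m _ 2))))
          (≢-by-toℕ x≡1+w toℕ-pₐ₋₂ (<⇒≢ (s≤s w<1+a'))) (≢-by-toℕ x≡1+w toℕ-pₐ₋₁ (<⇒≢ (≤-trans (s≤s w<1+a') (n≤1+n _))))))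
    where
    w<3+a' : w < 3 + a'
    w<3+a' = ≤-trans w<1+a' (m≤n+m _ 2)
    lhs : toℕ (⟦ commutator ⟧ x) ≡ suc w
    lhs = α-step (β-fix (α⁻¹-step (β⁻¹-fix (start x≡1+w) (s≤s w<1+a')) w<3+a') (≤-trans w<1+a' (n≤1+n _))) w<3+a'
  ... | at-a-2 x≡a-2 = trans (≡-by-toℕ lhs toℕ-pₐ₋₁) (sym rhs)
    where
    lhs : toℕ (⟦ commutator ⟧ x) ≡ 3 + a'
    lhs = α-step (β-wrap (α⁻¹-fix (β⁻¹-wrap (start x≡a-2)) (<last (m≤n+m _ 2)))) ≤-refl
    rhs : transpose p₀ pₐ (transpose pₐ₋₂ pₐ₋₁ x) ≡ pₐ₋₁
    rhs = trans (cong (transpose p₀ pₐ) (transpose-matchˡ (≡-by-toℕ x≡a-2 toℕ-pₐ₋₂)))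
                (transpose-other (≢-by-toℕ toℕ-pₐ₋₁ toℕ-p₀ λ ()) (≢-by-toℕ toℕ-pₐ₋₁ toℕ-pₐ (<⇒≢ ≤-refl)))
  ... | at-a-1 x≡a-1 = trans (≡-by-toℕ lhs toℕ-pₐ₋₂) (sym rhs)
    where
    lhs : toℕ (⟦ commutator ⟧ x) ≡ 2 + a'
    lhs = α-step (β-fix (α⁻¹-step (β⁻¹-step (start x≡a-1) ≤-refl (<last (m≤n+m _ 3))) (m≤n+m _ 1)) ≤-refl) (m≤n+m _ 1)
    rhs : transpose p₀ pₐ (transpose pₐ₋₂ pₐ₋₁ x) ≡ pₐ₋₂
    rhs = trans (cong (transpose p₀ pₐ) (transpose-matchʳ (≡-by-toℕ x≡a-1 toℕ-pₐ₋₁)))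
                (transpose-other (≢-by-toℕ toℕ-pₐ₋₂ toℕ-p₀ λ ()) (≢-by-toℕ toℕ-pₐ₋₂ toℕ-pₐ (<⇒≢ (m≤n+m _ 1))))
  ... | at-a x≡a = trans (≡-by-toℕ lhs toℕ-p₀) (sym rhs)
    where
    lhs : toℕ (⟦ commutator ⟧ x) ≡ 0
    lhs = α-wrap (β-step (α⁻¹-step (β⁻¹-step (start x≡a) (m≤n+m _ 1) (<last (m≤n+m _ 2))) ≤-refl) ≤-refl (<last (m≤n+m _ 3)))
    rhs : transpose p₀ pₐ (transpose pₐ₋₂ pₐ₋₁ x) ≡ p₀
    rhs = trans (cong (transpose p₀ pₐ) (transpose-other (≢-by-toℕ x≡a toℕ-pₐ₋₂ (>⇒≢ (m≤n+m _ 1)))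
                                                         (≢-by-toℕ x≡a toℕ-pₐ₋₁ (>⇒≢ ≤-refl))))
                (transpose-matchʳ (≡-by-toℕ x≡a toℕ-pₐ))
  ... | in-β w x≡1+w a≤w = trans (toℕ-injective (trans lhs (sym x≡1+w))) (sym (transpose²-other
          (≢-by-toℕ x≡1+w toℕ-p₀ λ ()) (≢-by-toℕ x≡1+w toℕ-pₐ (>⇒≢ (s≤s a≤w)))
          (≢-by-toℕ x≡1+w toℕ-pₐ₋₂ (>⇒≢ (≤-trans (m≤n+m _ 2) (s≤s a≤w))))
          (≢-by-toℕ x≡1+w toℕ-pₐ₋₁ (>⇒≢ (≤-trans (m≤n+m _ 1) (s≤s a≤w))))))
    where
    a-2≤w : 2 + a' ≤ w
    a-2≤w = ≤-trans (m≤n+m _ 2) a≤w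
    w<last : w < 6 + a' + b'
    w<last = s≤s⁻¹ (subst (_< n) x≡1+w (toℕ<n x))
    lhs : toℕ (⟦ commutator ⟧ x) ≡ suc w
    lhs = α-fix (β-step (α⁻¹-fix (β⁻¹-step (start x≡1+w) a-2≤w w<last) a≤w) a-2≤w w<last) (≤-trans a≤w (n≤1+n _))

  realises-≡ : ∀ {w i j k l i′ j′ k′ l′} → i ≡ i′ → j ≡ j′ → k ≡ k′ → l ≡ l′ →
               Realises w i j k l → Realises w i′ j′ k′ l′
  realises-≡ refl refl refl refl w≗ττ = w≗ττ

  γ : List Shift
  γ = β⁻¹ ∷ α⁻¹ ∷ β⁻¹ ∷ α ∷ β ∷ β ∷ []

  γ-p₀ : ⟦ γ ⟧ p₀ ≡ p₀
  γ-p₀ = ≡-by-toℕ (β⁻¹-fix (α⁻¹-step (β⁻¹-fix (α-step (β-fix (β-fix (start toℕ-p₀) z<s) z<s) z<s) (s≤s z<s)) z<s) z<s) toℕ-p₀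

  γ-pₐ : ⟦ γ ⟧ pₐ ≡ pₐ
  γ-pₐ = ≡-by-toℕ (β⁻¹-step (α⁻¹-fix (β⁻¹-step (α-fix
                    (β-step (β-step (start toℕ-pₐ) (m≤n+m _ 2) (<last (m≤n+m _ 1))) (m≤n+m _ 3) (<last ≤-refl))
                    (m≤n+m _ 2)) (m≤n+m _ 3) (<last ≤-refl)) (m≤n+m _ 1)) (m≤n+m _ 2) (<last (m≤n+m _ 1))) toℕ-pₐ

  γ-pₐ₋₂ : ⟦ γ ⟧ pₐ₋₂ ≡ pₙ₋₁
  γ-pₐ₋₂ = ≡-by-toℕ (β⁻¹-wrap (α⁻¹-step (β⁻¹-step (α-fix
                      (β-step (β-step (start toℕ-pₐ₋₂) ≤-refl (<last (m≤n+m _ 3))) (m≤n+m _ 1) (<last (m≤n+m _ 2)))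
                      ≤-refl) (m≤n+m _ 1) (<last (m≤n+m _ 2))) ≤-refl)) toℕ-pₙ₋₁

  γ-pₐ₋₁ : ⟦ γ ⟧ pₐ₋₁ ≡ pₐ₋₁
  γ-pₐ₋₁ = ≡-by-toℕ (β⁻¹-step (α⁻¹-fix (β⁻¹-step (α-fix
                      (β-step (β-step (start toℕ-pₐ₋₁) (m≤n+m _ 1) (<last (m≤n+m _ 2))) (m≤n+m _ 2) (<last (m≤n+m _ 1)))
                      (m≤n+m _ 1)) (m≤n+m _ 2) (<last (m≤n+m _ 1))) ≤-refl) (m≤n+m _ 1) (<last (m≤n+m _ 2))) toℕ-pₐ₋₁

  threeCycle : List Shift
  threeCycle = commutator ++ conjugate γ commutator

  threeCycle-realises : Realises threeCycle pₐ₋₂ pₐ₋₁ pₙ₋₁ pₐ₋₁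
  threeCycle-realises = realises-++ commutator-realises
    (realises-≡ γ-p₀ γ-pₐ γ-pₐ₋₂ γ-pₐ₋₁ (realises-conjugate γ commutator-realises))
    (≢-by-toℕ toℕ-pₐ₋₂ toℕ-p₀ λ ()) (≢-by-toℕ toℕ-pₐ₋₂ toℕ-pₐ (<⇒≢ (m≤n+m _ 1)))
    (≢-by-toℕ toℕ-pₐ₋₁ toℕ-p₀ λ ()) (≢-by-toℕ toℕ-pₐ₋₁ toℕ-pₐ (<⇒≢ ≤-refl))

  threeCycleα : List Shift
  threeCycleα = conjugate (β ∷ β ∷ []) threeCycle

  threeCycleα-realises : Realises threeCycleα pₐ pₐ₊₁ pₐ₋₁ pₐ₊₁
  threeCycleα-realises = realises-≡ ββ-pₐ₋₂ ββ-pₐ₋₁ ββ-pₙ₋₁ ββ-pₐ₋₁ (realises-conjugate (β ∷ β ∷ []) threeCycle-realises)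
    where
    ββ-pₐ₋₂ : ⟦ β ∷ β ∷ [] ⟧ pₐ₋₂ ≡ pₐ
    ββ-pₐ₋₂ = ≡-by-toℕ (β-step (β-step (start toℕ-pₐ₋₂) ≤-refl (<last (m≤n+m _ 3))) (m≤n+m _ 1) (<last (m≤n+m _ 2))) toℕ-pₐ
    ββ-pₐ₋₁ : ⟦ β ∷ β ∷ [] ⟧ pₐ₋₁ ≡ pₐ₊₁
    ββ-pₐ₋₁ = ≡-by-toℕ (β-step (β-step (start toℕ-pₐ₋₁) (m≤n+m _ 1) (<last (m≤n+m _ 2))) (m≤n+m _ 2) (<last (m≤n+m _ 1))) toℕ-pₐ₊₁
    ββ-pₙ₋₁ : ⟦ β ∷ β ∷ [] ⟧ pₙ₋₁ ≡ pₐ₋₁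
    ββ-pₙ₋₁ = ≡-by-toℕ (β-step (β-wrap (start toℕ-pₙ₋₁)) ≤-refl (<last (m≤n+m _ 3))) toℕ-pₐ₋₁

  threeCycleβ : List Shift
  threeCycleβ = conjugate (α⁻¹ ∷ α⁻¹ ∷ []) threeCycle

  threeCycleβ-realises : Realises threeCycleβ pₐ₋₄ pₐ₋₃ pₙ₋₁ pₐ₋₃
  threeCycleβ-realises = realises-≡ αα-pₐ₋₂ αα-pₐ₋₁ αα-pₙ₋₁ αα-pₐ₋₁ (realises-conjugate (α⁻¹ ∷ α⁻¹ ∷ []) threeCycle-realises)
    where
    αα-pₐ₋₂ : ⟦ α⁻¹ ∷ α⁻¹ ∷ [] ⟧ pₐ₋₂ ≡ pₐ₋₄
    αα-pₐ₋₂ = ≡-by-toℕ (α⁻¹-step (α⁻¹-step (start toℕ-pₐ₋₂) (m≤n+m _ 1)) (m≤n+m _ 2)) toℕ-pₐ₋₄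
    αα-pₐ₋₁ : ⟦ α⁻¹ ∷ α⁻¹ ∷ [] ⟧ pₐ₋₁ ≡ pₐ₋₃
    αα-pₐ₋₁ = ≡-by-toℕ (α⁻¹-step (α⁻¹-step (start toℕ-pₐ₋₁) ≤-refl) (m≤n+m _ 1)) toℕ-pₐ₋₃
    αα-pₙ₋₁ : ⟦ α⁻¹ ∷ α⁻¹ ∷ [] ⟧ pₙ₋₁ ≡ pₙ₋₁
    αα-pₙ₋₁ = ≡-by-toℕ (α⁻¹-fix (α⁻¹-fix (start toℕ-pₙ₋₁) (<last (m≤n+m _ 2))) (<last (m≤n+m _ 2))) toℕ-pₙ₋₁

  α-power : ∀ k {y} → toℕ y ≡ 0 → k < 4 + a' → toℕ (⟦ replicate k α ⟧ y) ≡ k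
  α-power zero    y≡0 _        = start y≡0
  α-power (suc k) y≡0 1+k<4+a' = α-step (α-power k y≡0 (<⇒≤ 1+k<4+a')) (s≤s⁻¹ 1+k<4+a')

  α-power-fix : ∀ k {y m} → toℕ y ≡ m → 3 + a' < m → toℕ (⟦ replicate k α ⟧ y) ≡ m
  α-power-fix zero    y≡m _      = start y≡m
  α-power-fix (suc k) y≡m a-1<m = α-fix (α-power-fix k y≡m a-1<m) a-1<m

  β-power : ∀ k {y} → toℕ y ≡ 2 + a' → k + (2 + a') ≤ 6 + a' + b' → toℕ (⟦ replicate k β ⟧ y) ≡ k + (2 + a')
  β-power zero    y≡a-2 _ = start y≡a-2
  β-power (suc k) y≡a-2 1+k+a-2≤last = β-step (β-power k y≡a-2 (<⇒≤ 1+k+a-2≤last)) (m≤n+m _ k) 1+k+a-2≤last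

  β-power-fix : ∀ k {y m} → toℕ y ≡ m → m < 2 + a' → toℕ (⟦ replicate k β ⟧ y) ≡ m
  β-power-fix zero    y≡m _      = start y≡m
  β-power-fix (suc k) y≡m m<a-2 = β-fix (β-power-fix k y≡m m<a-2) m<a-2

  alongα : Fin n → List Shift
  alongα x = replicate (toℕ x) α ++ [ α ]

  alongα-pₐ₋₁ : ∀ {x} → toℕ x < 4 + a' → ⟦ alongα x ⟧ pₐ₋₁ ≡ x
  alongα-pₐ₋₁ {x} x<a = trans (⟦⟧-++ (replicate (toℕ x) α) [ α ] pₐ₋₁) (toℕ-injective (α-power (toℕ x) (α-wrap (start toℕ-pₐ₋₁)) x<a))

  alongα-fix : ∀ x {y} → 3 + a' < toℕ y → ⟦ alongα x ⟧ y ≡ y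
  alongα-fix x {y} a-1<y = trans (⟦⟧-++ (replicate (toℕ x) α) [ α ] y) (toℕ-injective (α-power-fix (toℕ x) (α-fix (start refl) a-1<y) a-1<y))

  alongβ : Fin n → List Shift
  alongβ x = replicate (toℕ x ∸ (2 + a')) β ++ [ β ]

  alongβ-pₙ₋₁ : ∀ {x} → 2 + a' ≤ toℕ x → ⟦ alongβ x ⟧ pₙ₋₁ ≡ x
  alongβ-pₙ₋₁ {x} a-2≤x = trans (⟦⟧-++ (replicate k β) [ β ] pₙ₋₁)
                                 (toℕ-injective (trans (β-power k (β-wrap (start toℕ-pₙ₋₁)) k+a-2≤last) (m∸n+n≡m a-2≤x)))
    where
    k : ℕ
    k = toℕ x ∸ (2 + a')
    k+a-2≤last : k + (2 + a') ≤ 6 + a' + b'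
    k+a-2≤last = subst (_≤ 6 + a' + b') (sym (m∸n+n≡m a-2≤x)) (s≤s⁻¹ (toℕ<n x))

  alongβ-fix : ∀ x {y} → toℕ y < 2 + a' → ⟦ alongβ x ⟧ y ≡ y
  alongβ-fix x {y} y<a-2 = trans (⟦⟧-++ (replicate (toℕ x ∸ (2 + a')) β) [ β ] y)
                                 (toℕ-injective (β-power-fix (toℕ x ∸ (2 + a')) (β-fix (start refl) y<a-2) y<a-2))

  hookα hookβ : Fin n → List Shift
  hookα x = conjugate (alongα x) threeCycleα
  hookβ x = conjugate (alongβ x) threeCycleβ

  hookα-realises : ∀ {x} → toℕ x < 4 + a' → Realises (hookα x) pₐ pₐ₊₁ x pₐ₊₁
  hookα-realises {x} x<a =
    realises-≡ pₐ-fixed pₐ₊₁-fixed (alongα-pₐ₋₁ x<a) pₐ₊₁-fixed (realises-conjugate (alongα x) threeCycleα-realises)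
    where
    pₐ-fixed : ⟦ alongα x ⟧ pₐ ≡ pₐ
    pₐ-fixed = alongα-fix x (subst (3 + a' <_) (sym toℕ-pₐ) ≤-refl)
    pₐ₊₁-fixed : ⟦ alongα x ⟧ pₐ₊₁ ≡ pₐ₊₁
    pₐ₊₁-fixed = alongα-fix x (subst (3 + a' <_) (sym toℕ-pₐ₊₁) (m≤n+m _ 1))

  hookβ-realises : ∀ {x} → 2 + a' ≤ toℕ x → Realises (hookβ x) pₐ₋₄ pₐ₋₃ x pₐ₋₃
  hookβ-realises {x} a-2≤x =
    realises-≡ pₐ₋₄-fixed pₐ₋₃-fixed (alongβ-pₙ₋₁ a-2≤x) pₐ₋₃-fixed (realises-conjugate (alongβ x) threeCycleβ-realises)
    where
    pₐ₋₄-fixed : ⟦ alongβ x ⟧ pₐ₋₄ ≡ pₐ₋₄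
    pₐ₋₄-fixed = alongβ-fix x (subst (_< 2 + a') (sym toℕ-pₐ₋₄) (m≤n+m _ 1))
    pₐ₋₃-fixed : ⟦ alongβ x ⟧ pₐ₋₃ ≡ pₐ₋₃
    pₐ₋₃-fixed = alongβ-fix x (subst (_< 2 + a') (sym toℕ-pₐ₋₃) ≤-refl)

  length-conjugate : ∀ g w → length (conjugate g w) ≡ length g + (length w + length g)
  length-conjugate g w = trans (length-++ g) (cong (length g +_) (trans (length-++ w) (cong (length w +_) (length-inverse g))))

  length-hook : ∀ g w → length g ≤ n → length w ≡ 24 → length (conjugate g w) ≤ 26 * n
  length-hook g w g≤n w≡24 = begin
    length (conjugate g w)          ≡⟨ length-conjugate g w ⟩
    length g + (length w + length g) ≤⟨ +-mono-≤ g≤n (+-mono-≤ (≤-reflexive w≡24) g≤n) ⟩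
    n + (24 + n)                    ≤⟨ +-monoʳ-≤ n (≤-trans (≤-reflexive (+-comm 24 n)) (+-monoʳ-≤ n (m≤m*n 24 n))) ⟩
    26 * n                          ∎
    where open ≤-Reasoning

  length-replicate-∷ʳ : ∀ k (s : Shift) → length (replicate k s ++ [ s ]) ≡ suc k
  length-replicate-∷ʳ k s = trans (length-++ (replicate k s)) (trans (cong (_+ 1) (length-replicate k)) (+-comm k 1))

  length-alongα : ∀ x → length (alongα x) ≤ n
  length-alongα x = subst (_≤ n) (sym (length-replicate-∷ʳ (toℕ x) α)) (toℕ<n x)

  length-alongβ : ∀ x → length (alongβ x) ≤ n
  length-alongβ x = subst (_≤ n) (sym (length-replicate-∷ʳ (toℕ x ∸ (2 + a')) β)) (≤-trans (s≤s (m∸n≤m (toℕ x) (2 + a'))) (toℕ<n x))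

  Ordinary : Fin n → Set
  Ordinary x = x ≢ pₐ₋₃ × x ≢ pₐ₊₁ × x ≢ pₐ₋₁

  record Move (bound : ℕ) (y t : Fin n) : Set where
    field
      word    : List Shift
      length≤ : length word ≤ bound
      sends   : ⟦ word ⟧ y ≡ t
      fixes   : ∀ {x} → Ordinary x → x ≢ y → x ≢ t → ⟦ word ⟧ x ≡ x
      even    : PreservesParity ⟦ word ⟧ₚ

  move-by-realises : ∀ {bound w y t v} → Realises w t v y v → y ≢ v → t ≢ v → (∀ {x} → Ordinary x → x ≢ v) →
                     length w ≤ bound → Move bound y t
  move-by-realises {w = w} {y} {t} {v} w≗ττ y≢v t≢v ordinary≢v w≤bound = record
    { word    = w
    ; length≤ = w≤bound
    ; sends   = trans (w≗ττ y) (trans (cong (transpose t v) (transpose-matchˡ {j = v} (refl {x = y}))) (transpose-matchʳ {i = t} (refl {x = v})))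
    ; fixes   = λ ord x≢y x≢t → trans (w≗ττ _) (transpose²-other x≢t (ordinary≢v ord) x≢y (ordinary≢v ord))
    ; even    = realises-preservesParity t≢v y≢v w≗ττ
    }

  move-trans : ∀ {k k′ y t} → Move k y pₐ₋₁ → Move k′ pₐ₋₁ t → Move (k + k′) y t
  move-trans {k} {k′} {y} {t} m₁ m₂ = record
    { word    = M₂.word ++ M₁.word
    ; length≤ = subst (_≤ k + k′) (sym (length-++ M₂.word))
                  (subst (length M₂.word + length M₁.word ≤_) (+-comm k′ k) (+-mono-≤ M₂.length≤ M₁.length≤))
    ; sends   = trans (⟦⟧-++ M₂.word M₁.word y) (trans (cong ⟦ M₂.word ⟧ M₁.sends) M₂.sends)
    ; fixes   = λ {x} ord x≢y x≢t → trans (⟦⟧-++ M₂.word M₁.word x)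
                  (trans (cong ⟦ M₂.word ⟧ (M₁.fixes ord x≢y (proj₂ (proj₂ ord)))) (M₂.fixes ord (proj₂ (proj₂ ord)) x≢t))
    ; even    = preservesParity-++ M₂.word M₁.word M₂.even M₁.even
    }
    where
    module M₁ = Move m₁
    module M₂ = Move m₂

  move-weaken : ∀ {k k′ y t} → k ≤ k′ → Move k y t → Move k′ y t
  move-weaken k≤k′ m = record { Move m; length≤ = ≤-trans (Move.length≤ m) k≤k′ }

  length-ρ : ∀ {g h} → length g ≤ 26 * n → length h ≤ 26 * n → length (inverse g ++ h) ≤ 52 * n
  length-ρ {g} {h} g≤ h≤ = begin
    length (inverse g ++ h)          ≡⟨ length-++ (inverse g) ⟩
    length (inverse g) + length h    ≡⟨ cong (_+ length h) (length-inverse g) ⟩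
    length g + length h              ≤⟨ +-mono-≤ g≤ h≤ ⟩
    26 * n + 26 * n                  ≡⟨ *-distribʳ-+ n 26 26 ⟨
    52 * n                           ∎
    where open ≤-Reasoning

  moveα : ∀ {y t} → toℕ y < 4 + a' → toℕ t < 4 + a' → t ≢ pₐ₊₁ → Move (52 * n) y t
  moveα {y} {t} y<a t<a t≢pₐ₊₁ = move-by-realises (realises-inverse-++ (hookα-realises t<a) (hookα-realises y<a))
    (≢-by-toℕ refl toℕ-pₐ₊₁ (<⇒≢ (≤-trans y<a (m≤n+m _ 1)))) t≢pₐ₊₁ (proj₁ ∘ proj₂)
    (length-ρ {hookα t} {hookα y} (length-hook (alongα t) threeCycleα (length-alongα t) refl) (length-hook (alongα y) threeCycleα (length-alongα y) refl))

  moveβ : ∀ {y t} → 2 + a' ≤ toℕ y → 2 + a' ≤ toℕ t → t ≢ pₐ₋₃ → Move (52 * n) y t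
  moveβ {y} {t} a-2≤y a-2≤t t≢pₐ₋₃ = move-by-realises (realises-inverse-++ (hookβ-realises a-2≤t) (hookβ-realises a-2≤y))
    (≢-by-toℕ refl toℕ-pₐ₋₃ (>⇒≢ a-2≤y)) t≢pₐ₋₃ proj₁
    (length-ρ {hookβ t} {hookβ y} (length-hook (alongβ t) threeCycleβ (length-alongβ t) refl) (length-hook (alongβ y) threeCycleβ (length-alongβ y) refl))

  pₐ₋₁<a : toℕ pₐ₋₁ < 4 + a'
  pₐ₋₁<a = subst (_< 4 + a') (sym toℕ-pₐ₋₁) ≤-refl

  a-2≤pₐ₋₁ : 2 + a' ≤ toℕ pₐ₋₁
  a-2≤pₐ₋₁ = subst (2 + a' ≤_) (sym toℕ-pₐ₋₁) (m≤n+m _ 1)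

  pₐ₋₁≢pₐ₋₃ : pₐ₋₁ ≢ pₐ₋₃
  pₐ₋₁≢pₐ₋₃ = ≢-by-toℕ toℕ-pₐ₋₁ toℕ-pₐ₋₃ (>⇒≢ (m≤n+m _ 1))

  pₐ₋₁≢pₐ₊₁ : pₐ₋₁ ≢ pₐ₊₁
  pₐ₋₁≢pₐ₊₁ = ≢-by-toℕ toℕ-pₐ₋₁ toℕ-pₐ₊₁ (<⇒≢ (m≤n+m _ 1))

  pₐ₋₃≢pₐ₊₁ : pₐ₋₃ ≢ pₐ₊₁
  pₐ₋₃≢pₐ₊₁ = ≢-by-toℕ toℕ-pₐ₋₃ toℕ-pₐ₊₁ (<⇒≢ (m≤n+m _ 3))

  ≮a⇒a-2≤ : ∀ {x : Fin n} → ¬ (toℕ x < 4 + a') → 2 + a' ≤ toℕ x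
  ≮a⇒a-2≤ x≮a = ≤-trans (m≤n+m _ 2) (≮⇒≥ x≮a)

  move : ∀ y t → t ≢ pₐ₋₃ → t ≢ pₐ₊₁ → Move (104 * n) y t
  move y t t≢pₐ₋₃ t≢pₐ₊₁ with toℕ y <? 4 + a' | toℕ t <? 4 + a'
  ... | yes y<a | yes t<a = move-weaken (*-monoˡ-≤ n (m≤n+m 52 52)) (moveα y<a t<a t≢pₐ₊₁)
  ... | yes y<a | no t≮a  = subst (λ k → Move k y t) (sym (*-distribʳ-+ n 52 52))
                              (move-trans (moveα y<a pₐ₋₁<a pₐ₋₁≢pₐ₊₁) (moveβ a-2≤pₐ₋₁ (≮a⇒a-2≤ t≮a) t≢pₐ₋₃))
  ... | no y≮a  | yes t<a = subst (λ k → Move k y t) (sym (*-distribʳ-+ n 52 52))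
                              (move-trans (moveβ (≮a⇒a-2≤ y≮a) a-2≤pₐ₋₁ pₐ₋₁≢pₐ₋₃) (moveα pₐ₋₁<a t<a t≢pₐ₊₁))
  ... | no y≮a  | no t≮a  = move-weaken (*-monoˡ-≤ n (m≤n+m 52 52)) (moveβ (≮a⇒a-2≤ y≮a) (≮a⇒a-2≤ t≮a) t≢pₐ₋₃)

  ordinary? : ∀ x → Dec (Ordinary x)
  ordinary? x = ¬? (x ≟ᶠ pₐ₋₃) ×-dec ¬? (x ≟ᶠ pₐ₊₁) ×-dec ¬? (x ≟ᶠ pₐ₋₁)

  record Placement (T : List (Fin n)) (π : Permutation′ n) : Set where
    field
      word    : List Shift
      length≤ : length word ≤ length T * (104 * n)
      places  : ∀ {x} → Ordinary x → x ∈ T ⊎ π ⟨$⟩ʳ x ≡ x → ⟦ word ⟧ (π ⟨$⟩ʳ x) ≡ x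
      even    : PreservesParity ⟦ word ⟧ₚ

  place : ∀ T π → Placement T π
  place [] π = record
    { word    = []
    ; length≤ = z≤n
    ; places  = λ { _ (inj₂ πx≡x) → trans ⟦⟧-[] πx≡x }
    ; even    = preservesParity-[]
    }
  place (t ∷ T) π with ordinary? t
  ... | no ¬ord = record
    { Placement P
    ; length≤ = ≤-trans (Placement.length≤ P) (m≤n+m _ (104 * n))
    ; places  = λ where
        ord (inj₁ (here x≡t))   → ⊥-elim (¬ord (subst Ordinary x≡t ord))
        ord (inj₁ (there x∈T))  → Placement.places P ord (inj₁ x∈T)
        ord (inj₂ πx≡x)         → Placement.places P ord (inj₂ πx≡x)
    }
    where
    P : Placement T π
    P = place T π
  ... | yes (t≢pₐ₋₃ , t≢pₐ₊₁ , _) = record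
    { word    = P.word ++ M.word
    ; length≤ = begin
        length (P.word ++ M.word)          ≡⟨ length-++ P.word ⟩
        length P.word + length M.word      ≤⟨ +-mono-≤ P.length≤ M.length≤ ⟩
        length T * (104 * n) + 104 * n     ≡⟨ +-comm _ (104 * n) ⟩
        length (t ∷ T) * (104 * n)         ∎
    ; places  = λ {x} ord placed → trans (⟦⟧-++ P.word M.word (π ⟨$⟩ʳ x)) (P.places ord (placed-after-move ord placed))
    ; even    = preservesParity-++ P.word M.word P.even M.even
    }
    where
    open ≤-Reasoning
    module M = Move (move (π ⟨$⟩ʳ t) t t≢pₐ₋₃ t≢pₐ₊₁)
    module P = Placement (place T (π ∘ₚ ⟦ M.word ⟧ₚ))

    t-placed : ∀ {x} → x ≡ t → ⟦ M.word ⟧ (π ⟨$⟩ʳ x) ≡ x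
    t-placed refl = M.sends

    placed-after-move : ∀ {x} → Ordinary x → x ∈ t ∷ T ⊎ π ⟨$⟩ʳ x ≡ x → x ∈ T ⊎ ⟦ M.word ⟧ (π ⟨$⟩ʳ x) ≡ x
    placed-after-move ord (inj₁ (here x≡t))  = inj₂ (t-placed x≡t)
    placed-after-move ord (inj₁ (there x∈T)) = inj₁ x∈T
    placed-after-move {x} ord (inj₂ πx≡x) with x ≟ᶠ t
    ... | yes x≡t = inj₂ (t-placed x≡t)
    ... | no x≢t  = inj₂ (trans (cong ⟦ M.word ⟧ πx≡x) (M.fixes ord x≢πt x≢t))
      where
      x≢πt : x ≢ π ⟨$⟩ʳ t
      x≢πt x≡πt = x≢t (Injection.injective (↔⇒↣ π) (trans πx≡x x≡πt))

  record Settlement (σ : Permutation′ n) : Set where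
    field
      word    : List Shift
      length≤ : length word ≤ (1 + n) * (104 * n)
      settles : ∀ x → x ≢ pₐ₋₃ → x ≢ pₐ₊₁ → ⟦ word ⟧ (σ ⟨$⟩ʳ x) ≡ x
      even    : PreservesParity ⟦ word ⟧ₚ

  settle : ∀ σ → Settlement σ
  settle σ = record
    { word    = M.word ++ P.word
    ; length≤ = begin
        length (M.word ++ P.word)                 ≡⟨ length-++ M.word ⟩
        length M.word + length P.word             ≤⟨ +-mono-≤ M.length≤ P.length≤ ⟩
        104 * n + length (allFin n) * (104 * n)   ≡⟨ cong (λ k → 104 * n + k * (104 * n)) (length-allFin {n}) ⟩
        (1 + n) * (104 * n)                       ∎
    ; settles = λ x x≢pₐ₋₃ x≢pₐ₊₁ → trans (⟦⟧-++ M.word P.word (σ ⟨$⟩ʳ x)) (last-move x≢pₐ₋₃ x≢pₐ₊₁ (x ≟ᶠ pₐ₋₁))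
    ; even    = preservesParity-++ M.word P.word M.even P.even
    }
    where
    open ≤-Reasoning
    module P = Placement (place (allFin n) σ)
    π : Permutation′ n
    π = σ ∘ₚ ⟦ P.word ⟧ₚ
    module M = Move (move (π ⟨$⟩ʳ pₐ₋₁) pₐ₋₁ pₐ₋₁≢pₐ₋₃ pₐ₋₁≢pₐ₊₁)

    last-move : ∀ {x} → x ≢ pₐ₋₃ → x ≢ pₐ₊₁ → Dec (x ≡ pₐ₋₁) → ⟦ M.word ⟧ (π ⟨$⟩ʳ x) ≡ x
    last-move _ _ (yes refl) = M.sends
    last-move {x} x≢pₐ₋₃ x≢pₐ₊₁ (no x≢pₐ₋₁) = trans (cong ⟦ M.word ⟧ πx≡x) (M.fixes ord x≢πpₐ₋₁ x≢pₐ₋₁)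
      where
      ord : Ordinary x
      ord = x≢pₐ₋₃ , x≢pₐ₊₁ , x≢pₐ₋₁
      πx≡x : π ⟨$⟩ʳ x ≡ x
      πx≡x = P.places ord (inj₁ (∈-allFin x))
      x≢πpₐ₋₁ : x ≢ π ⟨$⟩ʳ pₐ₋₁
      x≢πpₐ₋₁ x≡πpₐ₋₁ = x≢pₐ₋₁ (Injection.injective (↔⇒↣ π) (trans πx≡x x≡πpₐ₋₁))

  quadratic : (1 + n) * (104 * n) ≤ 208 * n * n
  quadratic = begin
    (1 + n) * (104 * n)   ≤⟨ *-monoˡ-≤ (104 * n) (+-monoˡ-≤ n {1} {n} (s≤s z≤n)) ⟩
    (n + n) * (104 * n)   ≡⟨ solve 1 (λ k → (k :+ k) :* (con 104 :* k) := con 208 :* k :* k) refl n ⟩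
    208 * n * n           ∎
    where
    open ≤-Reasoning
    open +-*-Solver

  generate : ∀ (σ : Permutation′ n) → IsEven σ →
             Σ (List Shift) λ ws → (length ws ≤ 208 * n * n) × (∀ x → runShifts a' b' ws x ≡ σ ⟨$⟩ʳ x)
  generate σ σ-even = inverse S.word , length≤ , λ x → trans (sym (⟦⟧≡runShifts (inverse S.word) x)) (undo x)
    where
    module S = Settlement (settle σ)
    π : Permutation′ n
    π = σ ∘ₚ ⟦ S.word ⟧ₚ

    π≈id : π ≈ Perm.id
    π≈id with fixes-all-but-two π pₐ₋₃≢pₐ₊₁ S.settles
    ... | inj₁ π≈id = π≈id
    ... | inj₂ π≈τ  = ⊥-elim (0ℙ≢1ℙ (begin
      0ℙ                                         ≡⟨ parity-even σ-even ⟨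
      parity (inversions σ)                      ≡⟨ S.even σ ⟨
      parity (inversions π)                      ≡⟨ cong parity (inversions-cong {π = π} {ρ = transposeₚ pₐ₋₃ pₐ₊₁} π≈τ) ⟩
      parity (inversions (transposeₚ pₐ₋₃ pₐ₊₁)) ≡⟨ inversions-transpose pₐ₋₃≢pₐ₊₁ ⟩
      1ℙ                                         ∎))
      where
      open ≡-Reasoning
      0ℙ≢1ℙ : 0ℙ ≢ 1ℙ
      0ℙ≢1ℙ ()

    undo : ∀ x → ⟦ inverse S.word ⟧ x ≡ σ ⟨$⟩ʳ x
    undo x = trans (cong ⟦ inverse S.word ⟧ (sym (π≈id x))) (⟦inverse⟧-⟦⟧ S.word (σ ⟨$⟩ʳ x))

    length≤ : length (inverse S.word) ≤ 208 * n * n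
    length≤ = ≤-trans (≤-reflexive (length-inverse S.word)) (≤-trans S.length≤ quadratic)

lemma2 : Σ ℕ λ C → (a' b' : ℕ) → (σ : Permutation′ (puzzleN a' b')) → IsEven σ →
    Σ (List Shift) λ ws → (length ws ≤ C * puzzleN a' b' * puzzleN a' b')
      × ((x : Fin (puzzleN a' b')) → runShifts a' b' ws x ≡ σ ⟨$⟩ʳ x)
lemma2 = 208 , λ a' b' → Puzzle.generate a' b'
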